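{- Let $O,P\in\mathbb{Z}^2$ be integer points of the plane and let $\delta>0$ be a positive integer which is not a perfect square. The set of points $Q\in(\mathbb{Z}[\sqrt{\delta}])^2$ such that both Euclidean distances $d(O,Q)$ and $d(P,Q)$ belong to the ring $\mathbb{Z}[\sqrt{\delta}]$ is Zariski-dense in the plane.
   Context: $\mathbb{Z}[\sqrt{\delta}]$ is viewed as a subring of $\mathbb{R}$; $d$ is the Euclidean distance. -}

module Defs where

open import Data.Nat using (ℕ; zero; suc)
open import Data.Integer using (ℤ; +_) renaming (_+_ to _+ℤ_; _*_ to _*ℤ_; -_ to -ℤ_)
open import Data.Fin using (Fin)
open import Data.Product using (_×_; _,_; Σ; ∃; ∃-syntax)
open import Relation.Binary.PropositionalEquality using (_≡_; _≢_)

-- Elements a + b·√δ of ℤ[√δ], represented by their (unique, since δ is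
-- not a perfect square) integer coordinates (a , b).
record Zδ : Set where
  constructor _+_√
  field
    re : ℤ
    im : ℤ
open Zδ public

module Ring (δ : ℕ) where
  infixl 6 _⊕_ _⊖_
  infixl 7 _⊗_

  _⊕_ : Zδ → Zδ → Zδ
  (a + b √) ⊕ (c + d √) = (a +ℤ c) + (b +ℤ d) √

  ⊝_ : Zδ → Zδ
  ⊝ (a + b √) = (-ℤ a) + (-ℤ b) √

  _⊖_ : Zδ → Zδ → Zδ
  x ⊖ y = x ⊕ (⊝ y)

  -- (a + b√δ)(c + d√δ) = (ac + δ bd) + (ad + bc)√δ
  _⊗_ : Zδ → Zδ → Zδ
  (a + b √) ⊗ (c + d √) = ((a *ℤ c) +ℤ ((+ δ) *ℤ (b *ℤ d))) + ((a *ℤ d) +ℤ (b *ℤ c)) √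

  𝟘 𝟙 : Zδ
  𝟘 = (+ 0) + (+ 0) √
  𝟙 = (+ 1) + (+ 0) √

  ι : ℤ → Zδ
  ι a = a + (+ 0) √

  _^_ : Zδ → ℕ → Zδ
  x ^ zero = 𝟙
  x ^ suc n = x ⊗ (x ^ n)

  Σᶠ : (n : ℕ) → (Fin n → Zδ) → Zδ
  Σᶠ zero f = 𝟘
  Σᶠ (suc n) f = f Fin.zero ⊕ Σᶠ n (λ i → f (Fin.suc i))

  -- A bivariate polynomial with coefficients in ℤ[√δ] and degree < n in each
  -- variable: c i j is the coefficient of X^i Y^j.
  Poly2 : ℕ → Set
  Poly2 n = Fin n → Fin n → Zδ

  eval : {n : ℕ} → Poly2 n → Zδ → Zδ → Zδ
  eval {n} c x y = Σᶠ n (λ i → Σᶠ n (λ j → c i j ⊗ ((x ^ Data.Fin.toℕ i) ⊗ (y ^ Data.Fin.toℕ j))))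

  NonzeroPoly : {n : ℕ} → Poly2 n → Set
  NonzeroPoly c = ∃[ i ] ∃[ j ] (c i j ≢ 𝟘)

  ZariskiDense : (Zδ × Zδ → Set) → Set
  ZariskiDense S = (n : ℕ) (c : Poly2 n) → NonzeroPoly c →
                   ∃[ Q ] (S Q × eval c (Data.Product.proj₁ Q) (Data.Product.proj₂ Q) ≢ 𝟘)

  sqDist : ℤ × ℤ → Zδ × Zδ → Zδ
  sqDist (o₁ , o₂) (x , y) = ((x ⊖ ι o₁) ⊗ (x ⊖ ι o₁)) ⊕ ((y ⊖ ι o₂) ⊗ (y ⊖ ι o₂))

  -- d(O,Q) ∈ ℤ[√δ]: the real number √(sqDist) lies in ℤ[√δ], i.e. some
  -- r ∈ ℤ[√δ] has r² = sqDist (r or -r is the nonnegative root).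
  DistIn : ℤ × ℤ → Zδ × Zδ → Set
  DistIn O Q = ∃[ r ] (r ⊗ r ≡ sqDist O Q)

IsSquare : ℕ → Set
IsSquare δ = ∃[ k ] (k Data.Nat.* k ≡ δ)
  where import Data.Nat

{-# OPTIONS --safe #-}
module Submission where

-- Let ε = x₀ + y₀√δ be a unit of norm 1 with y₀ ≥ 1 (it exists because the continued fraction of
-- ⌊√δ⌋ + √δ is periodic) and θ = εʲ⁺¹ = a + b√δ.  The line through O of slope μ = b√δ has
-- 1 + μ² = a², so O + t(1, μ) is at distance a·t from O.  With g = μ(p₁ − o₁) − (p₂ − o₂), the point
-- at parameter t = (p₁ − o₁) + τ is at distance r from P as soon as τ² + (μτ + g)² = r².  From
-- θ² = 2aθ − 1 one gets θ^{4a} ≡ 1 (mod a²), so θ^{1+4ak} = X + Y√δ has X ≡ 0 (mod a) and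
-- Y ≡ b (mod a²), and τ = g√δ(Y − b)/a², r = gX/a is a solution in ℤ[√δ].  A polynomial vanishing
-- at all these points vanishes on infinitely many lines through O, hence on every line through O,
-- hence (moving along the units εᵏ) everywhere.  Cancellation in ℤ[√δ] holds because δ is not a square.

open import Defs
open import Data.Nat using (ℕ; _≤_)
open import Data.Integer using (ℤ)
open import Data.Product using (_×_)
open import Relation.Nullary using (¬_)

open import Algebra.Bundles using (CommutativeRing)
open import Algebra.Structures using (IsCommutativeRing)
import Algebra.Properties.CommutativeSemigroup as CommutativeSemigroupProperties
import Algebra.Properties.Group as GroupProperties
import Algebra.Solver.Ring
open import Algebra.Solver.Ring.AlmostCommutativeRing using (fromCommutativeRing; _-Raw-AlmostCommutative⟶_)
import Algebra.Solver.Ring.NaturalCoefficients.Default as SemiringSolver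
open import Data.Empty using (⊥-elim)
open import Data.Fin as Fin using (Fin; toℕ)
import Data.Fin.Properties as Fin
open import Data.Integer as ℤ using (+_; 0ℤ; -_; _-_; ∣_∣) renaming (_+_ to _+ℤ_; _*_ to _*ℤ_)
import Data.Integer.Properties as ℤ
import Data.Integer.Tactic.RingSolver as ℤ-Solver
open import Data.List using (_∷_; [])
open import Data.Maybe using (Maybe; just; nothing)
open import Data.Nat hiding (_^_; _≟_)
open import Data.Nat.Coprimality using (coprime-/gcd; coprime-divisor)
import Data.Nat.Coprimality as Coprime
open import Data.Nat.Divisibility using (_∣_; divides; ∣-refl)
open import Data.Nat.DivMod using (m/n*n≡m; m/n*n≤m; m≡m%n+[m/n]*n; m%n<n; m≥n⇒m/n>0)
open import Data.Nat.GCD using (gcd; gcd[m,n]∣m; gcd[m,n]∣n; gcd[m,n]≢0)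
open import Data.Nat.GeneralisedArithmetic using (fold)
open import Data.Nat.Properties hiding (_≟_)
import Data.Nat.Tactic.RingSolver as ℕ-Solver
open import Data.Product using (_,_; proj₁; proj₂; ∃-syntax)
open import Data.Sum using (_⊎_; inj₁; inj₂)
open import Function using (_∘_)
open import Level using (0ℓ)
open import Relation.Binary.Definitions using (tri<; tri≈; tri>)
open import Relation.Binary.PropositionalEquality
open import Relation.Nullary using (Dec; yes; no; contradiction)

module _ {A : Set} (f : A → A) {Good : A → Set}
         (f-good : ∀ {x} → Good x → Good (f x))
         (f-injective : ∀ {x y} → Good x → Good y → f x ≡ f y → x ≡ y)
         {K : ℕ} (code : ∀ {x} → Good x → Fin K)
         (code-injective : ∀ {x y} (gx : Good x) (gy : Good y) → code gx ≡ code gy → x ≡ y)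
         where

  private
    fold-good : ∀ {x} → Good x → ∀ n → Good (fold x f n)
    fold-good gx zero = gx
    fold-good gx (suc n) = f-good (fold-good gx n)

    unwind : ∀ {x} → Good x → ∀ i {n} → fold x f i ≡ fold x f (i + n) → x ≡ fold x f n
    unwind gx zero eq = eq
    unwind gx (suc i) {n} eq = unwind gx i (f-injective (fold-good gx i) (fold-good gx (i + n)) eq)

  orbit-periodic : ∀ {x} → Good x → ∃[ d ] fold x f (suc d) ≡ x
  orbit-periodic {x} gx with Fin.pigeonhole (n<1+n K) (λ i → code (fold-good gx (toℕ i)))
  ... | i , j , i<j , same-code with m≤n⇒∃[o]m+o≡n i<j
  ...   | d , i+1+d≡j = d , sym (unwind gx (toℕ i) orbit-i≡orbit-j)
    where
    orbit-i≡orbit-j : fold x f (toℕ i) ≡ fold x f (toℕ i + suc d)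
    orbit-i≡orbit-j = trans (code-injective _ _ same-code) (cong (fold x f) (sym (trans (+-suc (toℕ i) d) i+1+d≡j)))

-- Polynomial functions on an integral domain

module PolynomialFunctions {A : Set} {plus times : A → A → A} {negate : A → A} {zero′ one : A}
                           (isCommutativeRing : IsCommutativeRing _≡_ plus times negate zero′ one) where

  private
    ring : CommutativeRing 0ℓ 0ℓ
    ring = record { isCommutativeRing = isCommutativeRing }
  open CommutativeRing ring
    using (+-group; commutativeSemiring)
    renaming ( _+_ to _⊕_; _*_ to _⊗_; -_ to ⊝_; 0# to 𝟘; 1# to 𝟙; +-comm to ⊕-comm; +-assoc to ⊕-assoc
             ; +-identityʳ to ⊕-identityʳ; -‿inverseˡ to ⊝-inverseˡ; *-identityʳ to ⊗-identityʳ; zeroʳ to ⊗-zeroʳ )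
  open SemiringSolver commutativeSemiring using (solve; _:=_; _:+_; _:*_; con)

  infixl 6 _⊖_
  _⊖_ : A → A → A
  x ⊖ y = x ⊕ (⊝ y)

  -- Degree < n, characterised through divided differences rather than coefficients.
  DegreeBelow : ℕ → (A → A) → Set
  DegreeBelow zero F = ∀ x → F x ≡ 𝟘
  DegreeBelow (suc n) F = ∀ a → ∃[ G ] DegreeBelow n G × (∀ x → F x ≡ F a ⊕ (x ⊖ a) ⊗ G x)

  degreeBelow-ext : ∀ n {F H} → (∀ x → F x ≡ H x) → DegreeBelow n F → DegreeBelow n H
  degreeBelow-ext zero F≗H F≡𝟘 x = trans (sym (F≗H x)) (F≡𝟘 x)
  degreeBelow-ext (suc n) F≗H degF a with degF a
  ... | G , degG , F≡ = G , degG , λ x → trans (sym (F≗H x)) (trans (F≡ x) (cong (_⊕ _) (F≗H a)))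

  degreeBelow-zero : ∀ n → DegreeBelow n (λ _ → 𝟘)
  degreeBelow-zero zero x = refl
  degreeBelow-zero (suc n) a = (λ _ → 𝟘) , degreeBelow-zero n , λ x → solve 1 (λ d → con 0 := con 0 :+ d :* con 0) refl (x ⊖ a)

  degreeBelow-const : ∀ c → DegreeBelow 1 (λ _ → c)
  degreeBelow-const c a = (λ _ → 𝟘) , (λ _ → refl) , λ x → solve 2 (λ c d → c := c :+ d :* con 0) refl c (x ⊖ a)

  degreeBelow-id : DegreeBelow 2 (λ x → x)
  degreeBelow-id a = (λ _ → 𝟙) , degreeBelow-const 𝟙 , λ x → sym (trans (cong (a ⊕_) (⊗-identityʳ (x ⊖ a))) (a⊕[x⊖a]≡x x))
    where
    a⊕[x⊖a]≡x : ∀ x → a ⊕ (x ⊖ a) ≡ x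
    a⊕[x⊖a]≡x x = trans (⊕-comm a (x ⊖ a)) (trans (⊕-assoc x (⊝ a) a) (trans (cong (x ⊕_) (⊝-inverseˡ a)) (⊕-identityʳ x)))

  degreeBelow-suc : ∀ n {F} → DegreeBelow n F → DegreeBelow (suc n) F
  degreeBelow-suc zero {F} F≡𝟘 a = (λ _ → 𝟘) , (λ _ → refl) , λ x →
    trans (F≡𝟘 x) (trans (solve 1 (λ d → con 0 := con 0 :+ d :* con 0) refl (x ⊖ a)) (cong (_⊕ _) (sym (F≡𝟘 a))))
  degreeBelow-suc (suc n) degF a with degF a
  ... | G , degG , F≡ = G , degreeBelow-suc n degG , F≡

  degreeBelow-mono : ∀ {m n F} → m ≤ n → DegreeBelow m F → DegreeBelow n F
  degreeBelow-mono {m} {F = F} m≤n degF with m≤n⇒∃[o]m+o≡n m≤n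
  ... | k , refl = go k
    where
    go : ∀ k → DegreeBelow (m + k) F
    go zero = subst (λ n → DegreeBelow n F) (sym (+-identityʳ m)) degF
    go (suc k) = subst (λ n → DegreeBelow n F) (sym (+-suc m k)) (degreeBelow-suc (m + k) (go k))

  degreeBelow-⊕ : ∀ n {F H} → DegreeBelow n F → DegreeBelow n H → DegreeBelow n (λ x → F x ⊕ H x)
  degreeBelow-⊕ zero F≡𝟘 H≡𝟘 x = trans (cong₂ _⊕_ (F≡𝟘 x) (H≡𝟘 x)) (⊕-identityʳ 𝟘)
  degreeBelow-⊕ (suc n) {F} {H} degF degH a with degF a | degH a
  ... | G , degG , F≡ | K , degK , H≡ =
    (λ x → G x ⊕ K x) , degreeBelow-⊕ n degG degK ,
    λ x → trans (cong₂ _⊕_ (F≡ x) (H≡ x))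
                (solve 5 (λ fa ha d g k → (fa :+ d :* g) :+ (ha :+ d :* k) := (fa :+ ha) :+ d :* (g :+ k)) refl (F a) (H a) (x ⊖ a) (G x) (K x))

  degreeBelow-scale : ∀ n c {F} → DegreeBelow n F → DegreeBelow n (λ x → c ⊗ F x)
  degreeBelow-scale zero c F≡𝟘 x = trans (cong (c ⊗_) (F≡𝟘 x)) (⊗-zeroʳ c)
  degreeBelow-scale (suc n) c {F} degF a with degF a
  ... | G , degG , F≡ =
    (λ x → c ⊗ G x) , degreeBelow-scale n c degG ,
    λ x → trans (cong (c ⊗_) (F≡ x)) (solve 4 (λ c fa d g → c :* (fa :+ d :* g) := c :* fa :+ d :* (c :* g)) refl c (F a) (x ⊖ a) (G x))

  degreeBelow-⊗ : ∀ m n {F H} → DegreeBelow (suc m) F → DegreeBelow (suc n) H → DegreeBelow (suc (m + n)) (λ x → F x ⊗ H x)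
  degreeBelow-⊗ zero n {F} {H} degF degH with degF 𝟘
  ... | G , G≡𝟘 , F≡ = degreeBelow-ext (suc n) F𝟘⊗H≗F⊗H (degreeBelow-scale (suc n) (F 𝟘) degH)
    where
    F𝟘⊗H≗F⊗H : ∀ x → F 𝟘 ⊗ H x ≡ F x ⊗ H x
    F𝟘⊗H≗F⊗H x = cong (_⊗ H x) (sym (trans (F≡ x) (trans (cong (λ g → F 𝟘 ⊕ (x ⊖ 𝟘) ⊗ g) (G≡𝟘 x))
                                                         (solve 2 (λ c d → c :+ d :* con 0 := c) refl (F 𝟘) (x ⊖ 𝟘)))))
  degreeBelow-⊗ (suc m) n {F} {H} degF degH a with degF a | degH a
  ... | G , degG , F≡ | K , degK , H≡ =
    (λ x → G x ⊗ H x ⊕ F a ⊗ K x) ,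
    degreeBelow-⊕ (suc (m + n)) (degreeBelow-⊗ m n degG degH)
                  (degreeBelow-scale (suc (m + n)) (F a) (degreeBelow-mono (≤-trans (m≤n+m n m) (n≤1+n _)) degK)) ,
    λ x → begin
      F x ⊗ H x                                      ≡⟨ cong₂ _⊗_ (F≡ x) (H≡ x) ⟩
      (F a ⊕ (x ⊖ a) ⊗ G x) ⊗ (H a ⊕ (x ⊖ a) ⊗ K x)
        ≡⟨ solve 5 (λ fa ha d g k → (fa :+ d :* g) :* (ha :+ d :* k) := fa :* ha :+ d :* (g :* (ha :+ d :* k) :+ fa :* k))
                 refl (F a) (H a) (x ⊖ a) (G x) (K x) ⟩
      F a ⊗ H a ⊕ (x ⊖ a) ⊗ (G x ⊗ (H a ⊕ (x ⊖ a) ⊗ K x) ⊕ F a ⊗ K x)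
        ≡⟨ cong (λ h → F a ⊗ H a ⊕ (x ⊖ a) ⊗ (G x ⊗ h ⊕ F a ⊗ K x)) (sym (H≡ x)) ⟩
      F a ⊗ H a ⊕ (x ⊖ a) ⊗ (G x ⊗ H x ⊕ F a ⊗ K x)   ∎
    where open ≡-Reasoning

  module _ (x≢𝟘∧x⊗y≡𝟘⇒y≡𝟘 : ∀ {x y} → x ≢ 𝟘 → x ⊗ y ≡ 𝟘 → y ≡ 𝟘) where

    degreeBelow-roots⇒𝟘 : ∀ {n F} → DegreeBelow n F → (p : Fin n → A) → (∀ {i j} → p i ≡ p j → i ≡ j) →
                          (∀ i → F (p i) ≡ 𝟘) → ∀ x → F x ≡ 𝟘
    degreeBelow-roots⇒𝟘 {zero} F≡𝟘 p p-injective roots = F≡𝟘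
    degreeBelow-roots⇒𝟘 {suc n} {F} degF p p-injective roots x with degF (p Fin.zero)
    ... | G , degG , F≡ = begin
      F x                                      ≡⟨ F≡ x ⟩
      F (p Fin.zero) ⊕ (x ⊖ p Fin.zero) ⊗ G x  ≡⟨ cong₂ (λ c g → c ⊕ (x ⊖ p Fin.zero) ⊗ g) (roots Fin.zero) (G≡𝟘 x) ⟩
      𝟘 ⊕ (x ⊖ p Fin.zero) ⊗ 𝟘                 ≡⟨ solve 1 (λ d → con 0 :+ d :* con 0 := con 0) refl (x ⊖ p Fin.zero) ⟩
      𝟘                                        ∎
      where
      open ≡-Reasoning
      G≡𝟘 : ∀ y → G y ≡ 𝟘
      G≡𝟘 = degreeBelow-roots⇒𝟘 degG (p ∘ Fin.suc) (Fin.suc-injective ∘ p-injective) λ i →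
        x≢𝟘∧x⊗y≡𝟘⇒y≡𝟘
          (λ pᵢ₊₁⊖p₀≡𝟘 → Fin.0≢1+n (sym (p-injective (GroupProperties.x∙y⁻¹≈ε⇒x≈y +-group _ _ pᵢ₊₁⊖p₀≡𝟘))))
          (begin
            (p (Fin.suc i) ⊖ p Fin.zero) ⊗ G (p (Fin.suc i))                   ≡⟨ solve 1 (λ y → y := con 0 :+ y) refl _ ⟩
            𝟘 ⊕ (p (Fin.suc i) ⊖ p Fin.zero) ⊗ G (p (Fin.suc i))               ≡⟨ cong (_⊕ _) (sym (roots Fin.zero)) ⟩
            F (p Fin.zero) ⊕ (p (Fin.suc i) ⊖ p Fin.zero) ⊗ G (p (Fin.suc i))  ≡⟨ sym (F≡ (p (Fin.suc i))) ⟩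
            F (p (Fin.suc i))                                                  ≡⟨ roots (Fin.suc i) ⟩
            𝟘                                                                  ∎)

-- Arithmetic of natural numbers

integer-sqrt : ∀ n → ∃[ s ] s * s ≤ n × n < suc s * suc s
integer-sqrt zero = 0 , z≤n , s≤s z≤n
integer-sqrt (suc n) with integer-sqrt n
... | s , s²≤n , n<[1+s]² with suc n <? suc s * suc s
...   | yes 1+n<[1+s]² = s , ≤-trans s²≤n (n≤1+n n) , 1+n<[1+s]²
...   | no  1+n≮[1+s]² = suc s , ≮⇒≥ 1+n≮[1+s]² , ≤-trans (s≤s n<[1+s]²) (*-mono-< (n<1+n (suc s)) (n<1+n (suc s)))

m+n≤k⇒n*[k+m]+m*m≤k*k : ∀ {m n k} → m + n ≤ k → n * (k + m) + m * m ≤ k * k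
m+n≤k⇒n*[k+m]+m*m≤k*k {m} {n} m+n≤k with m≤n⇒∃[o]m+o≡n m+n≤k
... | j , refl = ≤-trans (m≤m+n _ (j * j + 2 * m * j + n * j)) (≤-reflexive (expand m n j))
  where
  expand : ∀ m n j → n * ((m + n + j) + m) + m * m + (j * j + 2 * m * j + n * j) ≡ (m + n + j) * (m + n + j)
  expand = ℕ-Solver.solve-∀

m≤k<m+q∧m+k<q′⇒[1+k]²≤q′*q+m*m : ∀ {m k q q′} → m ≤ k → k < m + q → m + k < q′ → suc k * suc k ≤ q′ * q + m * m
m≤k<m+q∧m+k<q′⇒[1+k]²≤q′*q+m*m {m} {k} {q} {q′} m≤k k<m+q m+k<q′ with m≤n⇒∃[o]m+o≡n (m≤n⇒m≤1+n m≤k)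
... | v , m+v≡1+k = begin
  suc k * suc k            ≡⟨ cong₂ _*_ m+v≡1+k m+v≡1+k ⟨
  (m + v) * (m + v)        ≡⟨ ℕ-Solver.solve (m ∷ v ∷ []) ⟩
  (m + m + v) * v + m * m  ≤⟨ +-monoˡ-≤ (m * m) (*-mono-≤ 2m+v≤q′ v≤q) ⟩
  q′ * q + m * m           ∎
  where
  open ≤-Reasoning
  v≤q : v ≤ q
  v≤q = +-cancelˡ-≤ m v q (≤-trans (≤-reflexive m+v≡1+k) k<m+q)
  2m+v≤q′ : m + m + v ≤ q′
  2m+v≤q′ = ≤-trans (≤-reflexive (trans (+-assoc m m v) (trans (cong (_+_ m) m+v≡1+k) (+-suc m k)))) m+k<q′

x+y≡a*q∧x+y′≡a′*q∧a<a′⇒y+q≤y′ : ∀ {x y y′ a a′ q} → a < a′ → x + y ≡ a * q → x + y′ ≡ a′ * q → y + q ≤ y′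
x+y≡a*q∧x+y′≡a′*q∧a<a′⇒y+q≤y′ {x} {y} {y′} {a} {a′} {q} a<a′ x+y≡aq x+y′≡a′q = +-cancelˡ-≤ x (y + q) y′ (begin
  x + (y + q)  ≡⟨ +-assoc x y q ⟨
  x + y + q    ≡⟨ cong (_+ q) x+y≡aq ⟩
  a * q + q    ≡⟨ +-comm (a * q) q ⟩
  suc a * q    ≤⟨ *-monoˡ-≤ q a<a′ ⟩
  a′ * q       ≡⟨ x+y′≡a′q ⟨
  x + y′       ∎)
  where open ≤-Reasoning

x+y≡a*q∧x+y′≡a′*q⇒y≡y′ : ∀ {x y y′ a a′ q s} → y ≤ s → s < y + q → y′ ≤ s → s < y′ + q →
                         x + y ≡ a * q → x + y′ ≡ a′ * q → y ≡ y′
x+y≡a*q∧x+y′≡a′*q⇒y≡y′ {x} {y} {y′} {a} {a′} y≤s s<y+q y′≤s s<y′+q x+y≡aq x+y′≡a′q with <-cmp a a′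
... | tri< a<a′ _ _ = contradiction (≤-trans (x+y≡a*q∧x+y′≡a′*q∧a<a′⇒y+q≤y′ a<a′ x+y≡aq x+y′≡a′q) y′≤s) (<⇒≱ s<y+q)
... | tri≈ _ refl _ = +-cancelˡ-≡ x y y′ (trans x+y≡aq (sym x+y′≡a′q))
... | tri> _ _ a′<a = contradiction (≤-trans (x+y≡a*q∧x+y′≡a′*q∧a<a′⇒y+q≤y′ a′<a x+y′≡a′q x+y≡aq) y≤s) (<⇒≱ s<y′+q)

QR+P²≡δ⇒Q′Q+P′²≡δ : ∀ {δ P Q R a P′ Q′} → P′ + P ≡ a * Q → Q′ + a * P′ ≡ R + a * P → Q * R + P * P ≡ δ →
            Q′ * Q + P′ * P′ ≡ δ
QR+P²≡δ⇒Q′Q+P′²≡δ {δ} {P} {Q} {R} {a} {P′} {Q′} P′+P≡aQ Q′+aP′≡R+aP QR+P²≡δ = +-cancelʳ-≡ (P * P′) _ _ (begin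
  Q′ * Q + P′ * P′ + P * P′  ≡⟨ ℕ-Solver.solve (Q′ ∷ Q ∷ P′ ∷ P ∷ []) ⟩
  Q′ * Q + P′ * (P′ + P)     ≡⟨ cong (λ x → Q′ * Q + P′ * x) P′+P≡aQ ⟩
  Q′ * Q + P′ * (a * Q)      ≡⟨ ℕ-Solver.solve (Q′ ∷ Q ∷ P′ ∷ a ∷ []) ⟩
  (Q′ + a * P′) * Q          ≡⟨ cong (_* Q) Q′+aP′≡R+aP ⟩
  (R + a * P) * Q            ≡⟨ ℕ-Solver.solve (R ∷ a ∷ P ∷ Q ∷ []) ⟩
  Q * R + P * (a * Q)        ≡⟨ cong (λ x → Q * R + P * x) P′+P≡aQ ⟨
  Q * R + P * (P′ + P)       ≡⟨ ℕ-Solver.solve (Q ∷ R ∷ P ∷ P′ ∷ []) ⟩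
  Q * R + P * P + P * P′     ≡⟨ cong (_+ P * P′) QR+P²≡δ ⟩
  δ + P * P′                 ∎)
  where open ≡-Reasoning

aP′≤R+aP : ∀ {δ P Q R a P′} .{{_ : NonZero Q}} → P′ + P ≡ a * Q → Q * R + P * P ≡ δ → P′ * P′ ≤ δ →
                   a * P′ ≤ R + a * P
aP′≤R+aP {δ} {P} {Q} {R} {a} {P′} P′+P≡aQ QR+P²≡δ P′²≤δ = *-cancelˡ-≤ Q (begin
  Q * (a * P′)            ≡⟨ ℕ-Solver.solve (Q ∷ a ∷ P′ ∷ []) ⟩
  P′ * (a * Q)            ≡⟨ cong (P′ *_) P′+P≡aQ ⟨
  P′ * (P′ + P)           ≡⟨ ℕ-Solver.solve (P′ ∷ P ∷ []) ⟩
  P′ * P′ + P * P′        ≤⟨ +-monoˡ-≤ (P * P′) P′²≤δ ⟩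
  δ + P * P′              ≡⟨ cong (_+ P * P′) QR+P²≡δ ⟨
  Q * R + P * P + P * P′  ≡⟨ ℕ-Solver.solve (Q ∷ R ∷ P ∷ P′ ∷ []) ⟩
  Q * R + P * (P′ + P)    ≡⟨ cong (λ x → Q * R + P * x) P′+P≡aQ ⟩
  Q * R + P * (a * Q)     ≡⟨ ℕ-Solver.solve (Q ∷ R ∷ P ∷ a ∷ []) ⟩
  Q * (R + a * P)         ∎)
  where open ≤-Reasoning

fixed-point-norm : ∀ {δ s p p₋ q q₋} → s * q + (q * s + q₋) ≡ p → s * (q * s + q₋) + δ * q ≡ p * s + p₋ →
                   (q * s + q₋) * (q * s + q₋) + p₋ * q ≡ δ * (q * q) + p * q₋
fixed-point-norm {δ} {s} {p} {p₋} {q} {q₋} im-eq re-eq = +-cancelʳ-≡ (p * s * q) _ _ (begin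
  (q * s + q₋) * (q * s + q₋) + p₋ * q + p * s * q  ≡⟨ ℕ-Solver.solve (q ∷ s ∷ q₋ ∷ p₋ ∷ p ∷ []) ⟩
  (q * s + q₋) * (q * s + q₋) + q * (p * s + p₋)    ≡⟨ cong (λ y → (q * s + q₋) * (q * s + q₋) + q * y) re-eq ⟨
  (q * s + q₋) * (q * s + q₋) + q * (s * (q * s + q₋) + δ * q)
                                                      ≡⟨ ℕ-Solver.solve (q ∷ s ∷ q₋ ∷ δ ∷ []) ⟩
  δ * (q * q) + (s * q + (q * s + q₋)) * (q * s + q₋)  ≡⟨ cong (λ y → δ * (q * q) + y * (q * s + q₋)) im-eq ⟩
  δ * (q * q) + p * (q * s + q₋)                       ≡⟨ ℕ-Solver.solve (δ ∷ q ∷ p ∷ s ∷ q₋ ∷ []) ⟩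
  δ * (q * q) + p * q₋ + p * s * q                     ∎)
  where open ≡-Reasoning

square-of-norm-±1 : ∀ {δ X q} → X * X ≡ δ * (q * q) + 1 ⊎ δ * (q * q) ≡ X * X + 1 →
                    (X * X + δ * (q * q)) * (X * X + δ * (q * q)) ≡ δ * ((2 * X * q) * (2 * X * q)) + 1
square-of-norm-±1 {δ} {X} {q} (inj₁ X²≡D+1) = begin
  (X * X + δ * (q * q)) * (X * X + δ * (q * q))                      ≡⟨ cong (λ A → (A + δ * (q * q)) * (A + δ * (q * q))) X²≡D+1 ⟩
  (δ * (q * q) + 1 + δ * (q * q)) * (δ * (q * q) + 1 + δ * (q * q))  ≡⟨ ℕ-Solver.solve (δ ∷ q ∷ []) ⟩
  4 * ((δ * (q * q) + 1) * (δ * (q * q))) + 1                        ≡⟨ cong (λ A → 4 * (A * (δ * (q * q))) + 1) X²≡D+1 ⟨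
  4 * ((X * X) * (δ * (q * q))) + 1                                  ≡⟨ ℕ-Solver.solve (δ ∷ X ∷ q ∷ []) ⟩
  δ * ((2 * X * q) * (2 * X * q)) + 1                                ∎
  where open ≡-Reasoning
square-of-norm-±1 {δ} {X} {q} (inj₂ D≡X²+1) = begin
  (X * X + δ * (q * q)) * (X * X + δ * (q * q))  ≡⟨ cong (λ B → (X * X + B) * (X * X + B)) D≡X²+1 ⟩
  (X * X + (X * X + 1)) * (X * X + (X * X + 1))  ≡⟨ ℕ-Solver.solve (X ∷ []) ⟩
  4 * ((X * X) * (X * X + 1)) + 1                ≡⟨ cong (λ B → 4 * ((X * X) * B) + 1) D≡X²+1 ⟨
  4 * ((X * X) * (δ * (q * q))) + 1              ≡⟨ ℕ-Solver.solve (δ ∷ X ∷ q ∷ []) ⟩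
  δ * ((2 * X * q) * (2 * X * q)) + 1            ∎
  where open ≡-Reasoning

a+b≡d+c∧c≡b±1⇒a≡d±1 : ∀ {a b c d} → a + b ≡ d + c → c ≡ b + 1 ⊎ b ≡ c + 1 → a ≡ d + 1 ⊎ d ≡ a + 1
a+b≡d+c∧c≡b±1⇒a≡d±1 {a} {b} {c} {d} a+b≡d+c (inj₁ c≡b+1) = inj₁ (+-cancelʳ-≡ b a (d + 1) (begin
  a + b        ≡⟨ a+b≡d+c ⟩
  d + c        ≡⟨ cong (_+_ d) c≡b+1 ⟩
  d + (b + 1)  ≡⟨ ℕ-Solver.solve (d ∷ b ∷ []) ⟩
  d + 1 + b    ∎))
  where open ≡-Reasoning
a+b≡d+c∧c≡b±1⇒a≡d±1 {a} {b} {c} {d} a+b≡d+c (inj₂ b≡c+1) = inj₂ (+-cancelʳ-≡ c d (a + 1) (begin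
  d + c        ≡⟨ a+b≡d+c ⟨
  a + b        ≡⟨ cong (_+_ a) b≡c+1 ⟩
  a + (c + 1)  ≡⟨ ℕ-Solver.solve (a ∷ c ∷ []) ⟩
  a + 1 + c    ∎))
  where open ≡-Reasoning

nonsquare∧δ<[1+s]²⇒1≤s : ∀ {δ s} → ¬ IsSquare δ → δ < suc s * suc s → 1 ≤ s
nonsquare∧δ<[1+s]²⇒1≤s {s = zero} δ-nonsquare (s≤s z≤n) = ⊥-elim (δ-nonsquare (0 , refl))
nonsquare∧δ<[1+s]²⇒1≤s {s = suc _} _ _ = s≤s z≤n

module _ (f : ℕ → ℕ) (f-increasing : ∀ n → f n < f (suc n)) where

  increasing⇒strictMono : ∀ {m n} → m < n → f m < f n
  increasing⇒strictMono {m} {suc n} (s≤s m≤n) with m≤n⇒m<n∨m≡n m≤n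
  ... | inj₁ m<n  = <-trans (increasing⇒strictMono m<n) (f-increasing n)
  ... | inj₂ refl = f-increasing n

  increasing⇒injective : ∀ {m n} → f m ≡ f n → m ≡ n
  increasing⇒injective {m} {n} fm≡fn with <-cmp m n
  ... | tri< m<n _ _ = contradiction fm≡fn (<⇒≢ (increasing⇒strictMono m<n))
  ... | tri≈ _ m≡n _ = m≡n
  ... | tri> _ _ n<m = contradiction (sym fm≡fn) (<⇒≢ (increasing⇒strictMono n<m))

x*x≡y+1⇒1≤x : ∀ {x y} → x * x ≡ y + 1 → 1 ≤ x
x*x≡y+1⇒1≤x {zero} {y} 0≡y+1 = contradiction (trans 0≡y+1 (+-comm y 1)) (λ ())
x*x≡y+1⇒1≤x {suc x} _ = s≤s z≤n

nonsquare∧a²≡δb²⇒b≡0 : ∀ {δ a b} → ¬ IsSquare δ → a * a ≡ δ * (b * b) → b ≡ 0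
nonsquare∧a²≡δb²⇒b≡0 {δ} {a} {zero} _ _ = refl
nonsquare∧a²≡δb²⇒b≡0 {δ} {a} {b@(suc _)} δ-nonsquare a²≡δb² = ⊥-elim (δ-nonsquare (a₀ , a₀²≡δ))
  where
  g : ℕ
  g = gcd a b
  instance
    g≢0 : NonZero g
    g≢0 = ≢-nonZero (gcd[m,n]≢0 a b (inj₂ (λ ())))
  a₀ b₀ : ℕ
  a₀ = a / g
  b₀ = b / g
  a₀²≡δb₀² : a₀ * a₀ ≡ δ * (b₀ * b₀)
  a₀²≡δb₀² = *-cancelʳ-≡ _ _ (g * g) {{m*n≢0 g g}} (begin
    a₀ * a₀ * (g * g)          ≡⟨ [m*n]*[o*p]≡[m*o]*[n*p] a₀ a₀ g g ⟩
    (a₀ * g) * (a₀ * g)        ≡⟨ cong₂ _*_ (m/n*n≡m (gcd[m,n]∣m a b)) (m/n*n≡m (gcd[m,n]∣m a b)) ⟩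
    a * a                      ≡⟨ a²≡δb² ⟩
    δ * (b * b)                ≡⟨ cong₂ (λ u v → δ * (u * v)) (m/n*n≡m (gcd[m,n]∣n a b)) (m/n*n≡m (gcd[m,n]∣n a b)) ⟨
    δ * ((b₀ * g) * (b₀ * g))  ≡⟨ cong (δ *_) ([m*n]*[o*p]≡[m*o]*[n*p] b₀ g b₀ g) ⟩
    δ * ((b₀ * b₀) * (g * g))  ≡⟨ *-assoc δ _ _ ⟨
    δ * (b₀ * b₀) * (g * g)    ∎)
    where open ≡-Reasoning
  b₀∣a₀ : b₀ ∣ a₀
  b₀∣a₀ = coprime-divisor (Coprime.sym (coprime-/gcd a b)) (divides (δ * b₀) (trans a₀²≡δb₀² (sym (*-assoc δ b₀ b₀))))
  b₀≡1 : b₀ ≡ 1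
  b₀≡1 = coprime-/gcd a b (b₀∣a₀ , ∣-refl)
  a₀²≡δ : a₀ * a₀ ≡ δ
  a₀²≡δ = trans a₀²≡δb₀² (trans (cong (λ u → δ * (u * u)) b₀≡1) (*-identityʳ δ))

-- The ring ℤ[√δ]

module ℤ√ (δ : ℕ) where
  open Ring δ public

  private
    d : ℤ
    d = + δ

  ⊕-assoc : ∀ x y z → (x ⊕ y) ⊕ z ≡ x ⊕ (y ⊕ z)
  ⊕-assoc (a + b √) (c + e √) (f + g √) = cong₂ _+_√ (ℤ.+-assoc a c f) (ℤ.+-assoc b e g)
  ⊕-comm : ∀ x y → x ⊕ y ≡ y ⊕ x
  ⊕-comm (a + b √) (c + e √) = cong₂ _+_√ (ℤ.+-comm a c) (ℤ.+-comm b e)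
  ⊕-identityˡ : ∀ x → 𝟘 ⊕ x ≡ x
  ⊕-identityˡ (a + b √) = cong₂ _+_√ (ℤ.+-identityˡ a) (ℤ.+-identityˡ b)
  ⊕-identityʳ : ∀ x → x ⊕ 𝟘 ≡ x
  ⊕-identityʳ (a + b √) = cong₂ _+_√ (ℤ.+-identityʳ a) (ℤ.+-identityʳ b)
  ⊝-inverseˡ : ∀ x → (⊝ x) ⊕ x ≡ 𝟘
  ⊝-inverseˡ (a + b √) = cong₂ _+_√ (ℤ.+-inverseˡ a) (ℤ.+-inverseˡ b)
  ⊝-inverseʳ : ∀ x → x ⊕ (⊝ x) ≡ 𝟘
  ⊝-inverseʳ (a + b √) = cong₂ _+_√ (ℤ.+-inverseʳ a) (ℤ.+-inverseʳ b)
  ⊗-assoc : ∀ x y z → (x ⊗ y) ⊗ z ≡ x ⊗ (y ⊗ z)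
  ⊗-assoc (a + b √) (c + e √) (f + g √) = cong₂ _+_√ (re-assoc d a b c e f g) (im-assoc d a b c e f g)
    where
    re-assoc : ∀ d a b c e f g → (a *ℤ c +ℤ d *ℤ (b *ℤ e)) *ℤ f +ℤ d *ℤ ((a *ℤ e +ℤ b *ℤ c) *ℤ g)
                               ≡ a *ℤ (c *ℤ f +ℤ d *ℤ (e *ℤ g)) +ℤ d *ℤ (b *ℤ (c *ℤ g +ℤ e *ℤ f))
    re-assoc = ℤ-Solver.solve-∀
    im-assoc : ∀ d a b c e f g → (a *ℤ c +ℤ d *ℤ (b *ℤ e)) *ℤ g +ℤ (a *ℤ e +ℤ b *ℤ c) *ℤ f
                               ≡ a *ℤ (c *ℤ g +ℤ e *ℤ f) +ℤ b *ℤ (c *ℤ f +ℤ d *ℤ (e *ℤ g))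
    im-assoc = ℤ-Solver.solve-∀
  ⊗-comm : ∀ x y → x ⊗ y ≡ y ⊗ x
  ⊗-comm (a + b √) (c + e √) = cong₂ _+_√ (ℤ-Solver.solve (a ∷ b ∷ c ∷ e ∷ [])) (ℤ-Solver.solve (a ∷ b ∷ c ∷ e ∷ []))
  ⊗-identityˡ : ∀ x → 𝟙 ⊗ x ≡ x
  ⊗-identityˡ (a + b √) = cong₂ _+_√ (re-identity d a b) (im-identity a b)
    where
    re-identity : ∀ d a b → + 1 *ℤ a +ℤ d *ℤ (+ 0 *ℤ b) ≡ a
    re-identity = ℤ-Solver.solve-∀
    im-identity : ∀ a b → + 1 *ℤ b +ℤ + 0 *ℤ a ≡ b
    im-identity = ℤ-Solver.solve-∀
  ⊗-identityʳ : ∀ x → x ⊗ 𝟙 ≡ x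
  ⊗-identityʳ x = trans (⊗-comm x 𝟙) (⊗-identityˡ x)
  ⊗-distribˡ-⊕ : ∀ x y z → x ⊗ (y ⊕ z) ≡ (x ⊗ y) ⊕ (x ⊗ z)
  ⊗-distribˡ-⊕ (a + b √) (c + e √) (f + g √) = cong₂ _+_√ (re-distrib d a b c e f g) (im-distrib a b c e f g)
    where
    re-distrib : ∀ d a b c e f g → a *ℤ (c +ℤ f) +ℤ d *ℤ (b *ℤ (e +ℤ g))
                                 ≡ (a *ℤ c +ℤ d *ℤ (b *ℤ e)) +ℤ (a *ℤ f +ℤ d *ℤ (b *ℤ g))
    re-distrib = ℤ-Solver.solve-∀
    im-distrib : ∀ a b c e f g → a *ℤ (e +ℤ g) +ℤ b *ℤ (c +ℤ f) ≡ (a *ℤ e +ℤ b *ℤ c) +ℤ (a *ℤ g +ℤ b *ℤ f)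
    im-distrib = ℤ-Solver.solve-∀
  ⊗-distribʳ-⊕ : ∀ x y z → (y ⊕ z) ⊗ x ≡ (y ⊗ x) ⊕ (z ⊗ x)
  ⊗-distribʳ-⊕ x y z = trans (⊗-comm (y ⊕ z) x) (trans (⊗-distribˡ-⊕ x y z) (cong₂ _⊕_ (⊗-comm x y) (⊗-comm x z)))

  ⊕-⊗-isCommutativeRing : IsCommutativeRing _≡_ _⊕_ _⊗_ ⊝_ 𝟘 𝟙
  ⊕-⊗-isCommutativeRing = record
    { isRing = record
      { +-isAbelianGroup = record
        { isGroup = record
          { isMonoid = record
            { isSemigroup = record
              { isMagma = record { isEquivalence = isEquivalence ; ∙-cong = cong₂ _⊕_ }
              ; assoc = ⊕-assoc }
            ; identity = ⊕-identityˡ , ⊕-identityʳ }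
          ; inverse = ⊝-inverseˡ , ⊝-inverseʳ
          ; ⁻¹-cong = cong ⊝_ }
        ; comm = ⊕-comm }
      ; *-cong = cong₂ _⊗_
      ; *-assoc = ⊗-assoc
      ; *-identity = ⊗-identityˡ , ⊗-identityʳ
      ; distrib = ⊗-distribˡ-⊕ , ⊗-distribʳ-⊕ }
    ; *-comm = ⊗-comm }

  commutativeRing : CommutativeRing 0ℓ 0ℓ
  commutativeRing = record { isCommutativeRing = ⊕-⊗-isCommutativeRing }

  open IsCommutativeRing ⊕-⊗-isCommutativeRing public using () renaming (zeroʳ to ⊗-zeroʳ)

  x⊗[y⊗z]≡y⊗[x⊗z] : ∀ x y z → x ⊗ (y ⊗ z) ≡ y ⊗ (x ⊗ z)
  x⊗[y⊗z]≡y⊗[x⊗z] = CommutativeSemigroupProperties.x∙yz≈y∙xz (CommutativeRing.*-commutativeSemigroup commutativeRing)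

  ι-⊕ : ∀ a b → ι (a +ℤ b) ≡ ι a ⊕ ι b
  ι-⊕ a b = cong ((a +ℤ b) +_√) (sym (ℤ.+-identityʳ (+ 0)))

  ι-⊗ : ∀ a b → ι (a *ℤ b) ≡ ι a ⊗ ι b
  ι-⊗ a b = cong₂ _+_√ (re-ι d a b) (im-ι a b)
    where
    re-ι : ∀ d a b → a *ℤ b ≡ a *ℤ b +ℤ d *ℤ (+ 0 *ℤ + 0)
    re-ι = ℤ-Solver.solve-∀
    im-ι : ∀ a b → + 0 ≡ a *ℤ + 0 +ℤ + 0 *ℤ b
    im-ι = ℤ-Solver.solve-∀

  private
    ι-homomorphism : ℤ.+-*-rawRing -Raw-AlmostCommutative⟶ fromCommutativeRing commutativeRing
    ι-homomorphism = record
      { ⟦_⟧ = ι ; +-homo = ι-⊕ ; *-homo = ι-⊗ ; -‿homo = λ _ → refl ; 0-homo = refl ; 1-homo = refl }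

    ι-≟ : ∀ a b → Maybe (ι a ≡ ι b)
    ι-≟ a b with a ℤ.≟ b
    ... | yes a≡b = just (cong ι a≡b)
    ... | no _ = nothing

  open Algebra.Solver.Ring ℤ.+-*-rawRing (fromCommutativeRing commutativeRing) ι-homomorphism ι-≟ public
    using (solve; _:=_; _:+_; _:*_; :-_; _:-_; con)

  ℕ√ : ℕ → ℕ → Zδ
  ℕ√ a b = (+ a) + (+ b) √

  ℕ√-injective : ∀ {a b c e} → ℕ√ a b ≡ ℕ√ c e → a ≡ c × b ≡ e
  ℕ√-injective eq = ℤ.+-injective (cong re eq) , ℤ.+-injective (cong im eq)

  ℕ√-⊕ : ∀ a b c e → ℕ√ a b ⊕ ℕ√ c e ≡ ℕ√ (a + c) (b + e)
  ℕ√-⊕ a b c e = sym (cong₂ _+_√ (ℤ.pos-+ a c) (ℤ.pos-+ b e))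

  ℕ√-⊗ : ∀ a b c e → ℕ√ a b ⊗ ℕ√ c e ≡ ℕ√ (a * c + δ * (b * e)) (a * e + b * c)
  ℕ√-⊗ a b c e = sym (cong₂ _+_√
    (trans (ℤ.pos-+ (a * c) _) (cong₂ _+ℤ_ (ℤ.pos-* a c) (trans (ℤ.pos-* δ _) (cong (_*ℤ_ d) (ℤ.pos-* b e)))))
    (trans (ℤ.pos-+ (a * e) _) (cong₂ _+ℤ_ (ℤ.pos-* a e) (ℤ.pos-* b c))))

  ιₙ : ℕ → Zδ
  ιₙ n = ℕ√ n 0

  ιₙ-⊗-ℕ√ : ∀ m a b → ιₙ m ⊗ ℕ√ a b ≡ ℕ√ (m * a) (m * b)
  ιₙ-⊗-ℕ√ m a b = trans (ℕ√-⊗ m 0 a b)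
    (cong₂ ℕ√ (trans (cong (_+_ (m * a)) (*-zeroʳ δ)) (+-identityʳ _)) (+-identityʳ _))

  ιₙ-injective : ∀ {m n} → ιₙ m ≡ ιₙ n → m ≡ n
  ιₙ-injective eq = proj₁ (ℕ√-injective eq)

  ιₙ-+ : ∀ m n → ιₙ (m + n) ≡ ιₙ m ⊕ ιₙ n
  ιₙ-+ m n = trans (cong ι (ℤ.pos-+ m n)) (ι-⊕ (+ m) (+ n))

  ιₙ-* : ∀ m n → ιₙ (m * n) ≡ ιₙ m ⊗ ιₙ n
  ιₙ-* m n = trans (cong ι (ℤ.pos-* m n)) (ι-⊗ (+ m) (+ n))

  ι-⊗-componentwise : ∀ n y → ι n ⊗ y ≡ (n *ℤ re y) + (n *ℤ im y) √
  ι-⊗-componentwise n (c + e √) = cong₂ _+_√ (re-scale d n c e) (im-scale n c e)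
    where
    re-scale : ∀ d n c e → n *ℤ c +ℤ d *ℤ (+ 0 *ℤ e) ≡ n *ℤ c
    re-scale = ℤ-Solver.solve-∀
    im-scale : ∀ n c e → n *ℤ e +ℤ + 0 *ℤ c ≡ n *ℤ e
    im-scale = ℤ-Solver.solve-∀

  ι-⊗-cancel : ∀ {n} y → n ≢ 0ℤ → ι n ⊗ y ≡ 𝟘 → y ≡ 𝟘
  ι-⊗-cancel {n} (c + e √) n≢0 ny≡0 = cong₂ _+_√ (cancel (cong re ny≡0′)) (cancel (cong im ny≡0′))
    where
    ny≡0′ : (n *ℤ c) + (n *ℤ e) √ ≡ 𝟘
    ny≡0′ = trans (sym (ι-⊗-componentwise n (c + e √))) ny≡0
    cancel : ∀ {z} → n *ℤ z ≡ 0ℤ → z ≡ 0ℤ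
    cancel nz≡0 with ℤ.i*j≡0⇒i≡0∨j≡0 n nz≡0
    ... | inj₁ n≡0 = ⊥-elim (n≢0 n≡0)
    ... | inj₂ z≡0 = z≡0

  ⊖≡𝟘⇒≡ : ∀ {x y} → x ⊖ y ≡ 𝟘 → x ≡ y
  ⊖≡𝟘⇒≡ = GroupProperties.x∙y⁻¹≈ε⇒x≈y (CommutativeRing.+-group commutativeRing) _ _

  ⊕-cancelˡ : ∀ x {y z} → x ⊕ y ≡ x ⊕ z → y ≡ z
  ⊕-cancelˡ x = GroupProperties.∙-cancelˡ (CommutativeRing.+-group commutativeRing) x _ _

  ⊗-cancelˡ-if-regular : ∀ {x} → (∀ {y} → x ⊗ y ≡ 𝟘 → y ≡ 𝟘) → ∀ {y z} → x ⊗ y ≡ x ⊗ z → y ≡ z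
  ⊗-cancelˡ-if-regular {x} regular {y} {z} xy≡xz = ⊖≡𝟘⇒≡ (regular (begin
    x ⊗ (y ⊖ z)    ≡⟨ solve 3 (λ x y z → x :* (y :- z) := x :* y :- x :* z) refl x y z ⟩
    x ⊗ y ⊖ x ⊗ z  ≡⟨ cong (_⊖ x ⊗ z) xy≡xz ⟩
    x ⊗ z ⊖ x ⊗ z  ≡⟨ ⊝-inverseʳ (x ⊗ z) ⟩
    𝟘              ∎))
    where open ≡-Reasoning

  _≟_ : (x y : Zδ) → Dec (x ≡ y)
  (a + b √) ≟ (c + e √) with a ℤ.≟ c | b ℤ.≟ e
  ... | yes a≡c | yes b≡e = yes (cong₂ _+_√ a≡c b≡e)
  ... | no a≢c  | _       = no (λ eq → a≢c (cong re eq))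
  ... | yes _   | no b≢e  = no (λ eq → b≢e (cong im eq))

  √δ : Zδ
  √δ = (+ 0) + (+ 1) √

  √δ⊗√δ : √δ ⊗ √δ ≡ ιₙ δ
  √δ⊗√δ = cong₂ _+_√ (re-square d) refl
    where
    re-square : ∀ d → + 0 *ℤ + 0 +ℤ d *ℤ (+ 1 *ℤ + 1) ≡ d
    re-square = ℤ-Solver.solve-∀

  conj : Zδ → Zδ
  conj (a + b √) = a + (- b) √

  N : Zδ → ℤ
  N (a + b √) = a *ℤ a - d *ℤ (b *ℤ b)

  conj-⊗ : ∀ x → conj x ⊗ x ≡ ι (N x)
  conj-⊗ (a + b √) = cong₂ _+_√ (re-norm d a b) (im-norm a b)
    where
    re-norm : ∀ d a b → a *ℤ a +ℤ d *ℤ (- b *ℤ b) ≡ a *ℤ a - d *ℤ (b *ℤ b)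
    re-norm = ℤ-Solver.solve-∀
    im-norm : ∀ a b → a *ℤ b +ℤ - b *ℤ a ≡ + 0
    im-norm = ℤ-Solver.solve-∀

  N-⊗ : ∀ x y → N (x ⊗ y) ≡ N x *ℤ N y
  N-⊗ (a + b √) (c + e √) = norm-multiplicative d a b c e
    where
    norm-multiplicative : ∀ d a b c e →
      (a *ℤ c +ℤ d *ℤ (b *ℤ e)) *ℤ (a *ℤ c +ℤ d *ℤ (b *ℤ e)) - d *ℤ ((a *ℤ e +ℤ b *ℤ c) *ℤ (a *ℤ e +ℤ b *ℤ c))
      ≡ (a *ℤ a - d *ℤ (b *ℤ b)) *ℤ (c *ℤ c - d *ℤ (e *ℤ e))
    norm-multiplicative = ℤ-Solver.solve-∀

  N-ℕ√ : ∀ x y → N (ℕ√ x y) ≡ + (x * x) - + (δ * (y * y))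
  N-ℕ√ x y = sym (cong₂ _-_ (ℤ.pos-* x x) (trans (ℤ.pos-* δ _) (cong (_*ℤ_ d) (ℤ.pos-* y y))))

  pell⇒N-ℕ√≡1 : ∀ {x y} → x * x ≡ δ * (y * y) + 1 → N (ℕ√ x y) ≡ + 1
  pell⇒N-ℕ√≡1 {x} {y} x²≡δy²+1 = begin
    N (ℕ√ x y)          ≡⟨ N-ℕ√ x y ⟩
    + (x * x) - + D     ≡⟨ cong (λ z → + z - + D) x²≡δy²+1 ⟩
    + (D + 1) - + D     ≡⟨ cong (_- + D) (ℤ.pos-+ D 1) ⟩
    (+ D +ℤ + 1) - + D  ≡⟨ [i+1]-i≡1 (+ D) ⟩
    + 1                 ∎
    where
    open ≡-Reasoning
    D : ℕ
    D = δ * (y * y)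
    [i+1]-i≡1 : ∀ i → (i +ℤ + 1) - i ≡ + 1
    [i+1]-i≡1 = ℤ-Solver.solve-∀

  N-ℕ√≡1⇒pell : ∀ {x y} → N (ℕ√ x y) ≡ + 1 → x * x ≡ δ * (y * y) + 1
  N-ℕ√≡1⇒pell {x} {y} N≡1 = ℤ.+-injective (begin
    + (x * x)                 ≡⟨ i≡[i-j]+j (+ (x * x)) (+ D) ⟩
    (+ (x * x) - + D) +ℤ + D  ≡⟨ cong (_+ℤ + D) (trans (sym (N-ℕ√ x y)) N≡1) ⟩
    + 1 +ℤ + D                ≡⟨ ℤ.+-comm (+ 1) (+ D) ⟩
    + (D + 1)                 ∎)
    where
    open ≡-Reasoning
    D : ℕ
    D = δ * (y * y)
    i≡[i-j]+j : ∀ i j → i ≡ (i - j) +ℤ j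
    i≡[i-j]+j = ℤ-Solver.solve-∀

  pell⇒ιₙ : ∀ {x y} → x * x ≡ δ * (y * y) + 1 → ιₙ x ⊗ ιₙ x ≡ ιₙ δ ⊗ (ιₙ y ⊗ ιₙ y) ⊕ 𝟙
  pell⇒ιₙ {x} {y} x²≡δy²+1 = begin
    ιₙ x ⊗ ιₙ x               ≡⟨ ιₙ-* x x ⟨
    ιₙ (x * x)                ≡⟨ cong ιₙ x²≡δy²+1 ⟩
    ιₙ (δ * (y * y) + 1)      ≡⟨ ιₙ-+ (δ * (y * y)) 1 ⟩
    ιₙ (δ * (y * y)) ⊕ 𝟙      ≡⟨ cong (_⊕ 𝟙) (trans (ιₙ-* δ (y * y)) (cong (ιₙ δ ⊗_) (ιₙ-* y y))) ⟩
    ιₙ δ ⊗ (ιₙ y ⊗ ιₙ y) ⊕ 𝟙  ∎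
    where open ≡-Reasoning

  ^-+ : ∀ x m n → x ^ (m + n) ≡ x ^ m ⊗ x ^ n
  ^-+ x zero n = sym (⊗-identityˡ (x ^ n))
  ^-+ x (suc m) n = trans (cong (x ⊗_) (^-+ x m n)) (sym (⊗-assoc x (x ^ m) (x ^ n)))

  ^-* : ∀ x m n → x ^ (m * n) ≡ (x ^ n) ^ m
  ^-* x zero n = refl
  ^-* x (suc m) n = trans (^-+ x n (m * n)) (cong (x ^ n ⊗_) (^-* x m n))

  N-^ : ∀ x n → N x ≡ + 1 → N (x ^ n) ≡ + 1
  N-^ x zero Nx≡1 = N-𝟙 d
    where
    N-𝟙 : ∀ d → + 1 *ℤ + 1 - d *ℤ (+ 0 *ℤ + 0) ≡ + 1
    N-𝟙 = ℤ-Solver.solve-∀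
  N-^ x (suc n) Nx≡1 = trans (N-⊗ x (x ^ n)) (cong₂ _*ℤ_ Nx≡1 (N-^ x n Nx≡1))

  infix 4 _≡_[mod_]
  _≡_[mod_] : Zδ → Zδ → Zδ → Set
  x ≡ y [mod m ] = ∃[ q ] x ≡ y ⊕ m ⊗ q

  ≡-mod-trans : ∀ {x y z m} → x ≡ y [mod m ] → y ≡ z [mod m ] → x ≡ z [mod m ]
  ≡-mod-trans {x} {y} {z} {m} (q , x≡y+mq) (r , y≡z+mr) = r ⊕ q , (begin
    x                  ≡⟨ x≡y+mq ⟩
    y ⊕ m ⊗ q          ≡⟨ cong (_⊕ m ⊗ q) y≡z+mr ⟩
    z ⊕ m ⊗ r ⊕ m ⊗ q  ≡⟨ solve 4 (λ z m r q → z :+ m :* r :+ m :* q := z :+ m :* (r :+ q)) refl z m r q ⟩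
    z ⊕ m ⊗ (r ⊕ q)    ∎)
    where open ≡-Reasoning

  ≡-mod-⊗ : ∀ {x x′ y y′ m} → x ≡ x′ [mod m ] → y ≡ y′ [mod m ] → x ⊗ y ≡ x′ ⊗ y′ [mod m ]
  ≡-mod-⊗ {x} {x′} {y} {y′} {m} (q , x≡x′+mq) (r , y≡y′+mr) = q ⊗ y′ ⊕ x′ ⊗ r ⊕ m ⊗ (q ⊗ r) , (begin
    x ⊗ y                        ≡⟨ cong₂ _⊗_ x≡x′+mq y≡y′+mr ⟩
    (x′ ⊕ m ⊗ q) ⊗ (y′ ⊕ m ⊗ r)  ≡⟨ solve 5 (λ x′ y′ m q r → (x′ :+ m :* q) :* (y′ :+ m :* r)
                                                           := x′ :* y′ :+ m :* (q :* y′ :+ x′ :* r :+ m :* (q :* r))) refl x′ y′ m q r ⟩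
    x′ ⊗ y′ ⊕ m ⊗ (q ⊗ y′ ⊕ x′ ⊗ r ⊕ m ⊗ (q ⊗ r)) ∎)
    where open ≡-Reasoning

  ≡1-mod⇒^≡1-mod : ∀ {x m} → x ≡ 𝟙 [mod m ] → ∀ k → x ^ k ≡ 𝟙 [mod m ]
  ≡1-mod⇒^≡1-mod {m = m} x≡1 zero = 𝟘 , solve 1 (λ m → con (+ 1) := con (+ 1) :+ m :* con (+ 0)) refl m
  ≡1-mod⇒^≡1-mod {x} {m} x≡1 (suc k) = subst (λ z → x ⊗ x ^ k ≡ z [mod m ]) (⊗-identityˡ 𝟙)
    (≡-mod-⊗ {x} {𝟙} {x ^ k} {𝟙} {m} x≡1 (≡1-mod⇒^≡1-mod {x} {m} x≡1 k))

  [1+wr]^k≡1+kwr : ∀ w r k → (𝟙 ⊕ w ⊗ r) ^ k ≡ 𝟙 ⊕ ιₙ k ⊗ (w ⊗ r) [mod w ⊗ w ]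
  [1+wr]^k≡1+kwr w r zero = 𝟘 , solve 2 (λ w r → con (+ 1) := con (+ 1) :+ con (+ 0) :* (w :* r) :+ (w :* w) :* con (+ 0)) refl w r
  [1+wr]^k≡1+kwr w r (suc k) with [1+wr]^k≡1+kwr w r k
  ... | σ , eq = σ ⊕ ιₙ k ⊗ (r ⊗ r) ⊕ w ⊗ (r ⊗ σ) , (begin
    (𝟙 ⊕ w ⊗ r) ⊗ (𝟙 ⊕ w ⊗ r) ^ k
      ≡⟨ cong ((𝟙 ⊕ w ⊗ r) ⊗_) eq ⟩
    (𝟙 ⊕ w ⊗ r) ⊗ (𝟙 ⊕ ιₙ k ⊗ (w ⊗ r) ⊕ (w ⊗ w) ⊗ σ)
      ≡⟨ solve 4 (λ w r σ k → (con (+ 1) :+ w :* r) :* (con (+ 1) :+ k :* (w :* r) :+ (w :* w) :* σ)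
                    := con (+ 1) :+ (con (+ 1) :+ k) :* (w :* r) :+ (w :* w) :* (σ :+ k :* (r :* r) :+ w :* (r :* σ))) refl w r σ (ιₙ k) ⟩
    𝟙 ⊕ (𝟙 ⊕ ιₙ k) ⊗ (w ⊗ r) ⊕ (w ⊗ w) ⊗ (σ ⊕ ιₙ k ⊗ (r ⊗ r) ⊕ w ⊗ (r ⊗ σ))
      ≡⟨ cong (λ z → 𝟙 ⊕ z ⊗ (w ⊗ r) ⊕ (w ⊗ w) ⊗ (σ ⊕ ιₙ k ⊗ (r ⊗ r) ⊕ w ⊗ (r ⊗ σ))) (ιₙ-+ 1 k) ⟨
    𝟙 ⊕ ιₙ (suc k) ⊗ (w ⊗ r) ⊕ (w ⊗ w) ⊗ (σ ⊕ ιₙ k ⊗ (r ⊗ r) ⊕ w ⊗ (r ⊗ σ)) ∎)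
    where open ≡-Reasoning

  ≡1-mod⇒^≡1-mod-square : ∀ {x} n → x ≡ 𝟙 [mod ιₙ n ] → x ^ n ≡ 𝟙 [mod ιₙ n ⊗ ιₙ n ]
  ≡1-mod⇒^≡1-mod-square {x} n (r , x≡1+nr) = ≡-mod-trans {x ^ n} {𝟙 ⊕ ιₙ n ⊗ (ιₙ n ⊗ r)} {𝟙} {ιₙ n ⊗ ιₙ n}
    (subst (λ y → y ^ n ≡ 𝟙 ⊕ ιₙ n ⊗ (ιₙ n ⊗ r) [mod ιₙ n ⊗ ιₙ n ]) (sym x≡1+nr) ([1+wr]^k≡1+kwr (ιₙ n) r n))
    (r , solve 2 (λ w r → con (+ 1) :+ w :* (w :* r) := con (+ 1) :+ (w :* w) :* r) refl (ιₙ n) r)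

module ℤ√-Domain {δ : ℕ} (δ-nonsquare : ¬ IsSquare δ) where
  open ℤ√ δ

  N≡0⇒≡𝟘 : ∀ x → N x ≡ 0ℤ → x ≡ 𝟘
  N≡0⇒≡𝟘 (a + b √) Nx≡0 = cong₂ _+_√ a≡0 b≡0
    where
    a²≡δb² : a *ℤ a ≡ + δ *ℤ (b *ℤ b)
    a²≡δb² = ℤ.i-j≡0⇒i≡j _ _ Nx≡0
    b≡0 : b ≡ 0ℤ
    b≡0 = ℤ.∣i∣≡0⇒i≡0 (nonsquare∧a²≡δb²⇒b≡0 {a = ∣ a ∣} δ-nonsquare (begin
      ∣ a ∣ * ∣ a ∣        ≡⟨ ℤ.abs-* a a ⟨
      ∣ a *ℤ a ∣           ≡⟨ cong ∣_∣ a²≡δb² ⟩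
      ∣ + δ *ℤ (b *ℤ b) ∣  ≡⟨ ℤ.abs-* (+ δ) (b *ℤ b) ⟩
      δ * ∣ b *ℤ b ∣       ≡⟨ cong (δ *_) (ℤ.abs-* b b) ⟩
      δ * (∣ b ∣ * ∣ b ∣)  ∎))
      where open ≡-Reasoning
    a≡0 : a ≡ 0ℤ
    a≡0 with ℤ.i*j≡0⇒i≡0∨j≡0 a (trans a²≡δb² (trans (cong (λ b → + δ *ℤ (b *ℤ b)) b≡0) (ℤ.*-zeroʳ (+ δ))))
    ... | inj₁ a≡0 = a≡0
    ... | inj₂ a≡0 = a≡0

  x≢𝟘∧x⊗y≡𝟘⇒y≡𝟘 : ∀ {x y} → x ≢ 𝟘 → x ⊗ y ≡ 𝟘 → y ≡ 𝟘
  x≢𝟘∧x⊗y≡𝟘⇒y≡𝟘 {x} {y} x≢𝟘 xy≡𝟘 = ι-⊗-cancel y (λ Nx≡0 → x≢𝟘 (N≡0⇒≡𝟘 x Nx≡0)) (begin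
    ι (N x) ⊗ y       ≡⟨ cong (_⊗ y) (conj-⊗ x) ⟨
    (conj x ⊗ x) ⊗ y  ≡⟨ ⊗-assoc (conj x) x y ⟩
    conj x ⊗ (x ⊗ y)  ≡⟨ cong (conj x ⊗_) xy≡𝟘 ⟩
    conj x ⊗ 𝟘        ≡⟨ ⊗-zeroʳ (conj x) ⟩
    𝟘                 ∎)
    where open ≡-Reasoning

  ⊗-cancelˡ : ∀ {x y z} → x ≢ 𝟘 → x ⊗ y ≡ x ⊗ z → y ≡ z
  ⊗-cancelˡ {x} x≢𝟘 = ⊗-cancelˡ-if-regular {x} (x≢𝟘∧x⊗y≡𝟘⇒y≡𝟘 {x} x≢𝟘)

-- Pell's equation, via the periodicity of the continued fraction of ⌊√δ⌋ + √δ

module ContinuedFraction {δ s : ℕ} (1≤s : 1 ≤ s) (s²<δ : s * s < δ) (δ<[1+s]² : δ < suc s * suc s) where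
  open ℤ√ δ using (_⊕_; _⊗_; ℕ√; ℕ√-injective; ιₙ; ℕ√-⊗; ℕ√-⊕; ιₙ-*; ιₙ-+; ιₙ-⊗-ℕ√; ι-⊗-cancel; ⊗-cancelˡ-if-regular;
                   x⊗[y⊗z]≡y⊗[x⊗z]; solve; _:=_; _:+_; _:*_; con)

  -- ⟨ P , Q , R ⟩ stands for the complete quotient x = (P + √δ)/Q, where Q R = δ − P².
  record State : Set where
    constructor ⟨_,_,_⟩
    field
      P Q R : ℕ
  open State

  -- ⌊x⌋ = ⌊(P + s)/Q⌋; the value 0 for Q = 0 is junk, reduced states have Q ≠ 0.
  quotient : State → ℕ
  quotient ⟨ P , zero , R ⟩ = 0
  quotient ⟨ P , suc q , R ⟩ = (P + s) / suc q

  -- x = a + 1/x′ with x′ = (P′ + √δ)/Q′, P′ = aQ − P and Q′ = (δ − P′²)/Q = R + a(P − P′).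
  step : State → State
  step σ@(⟨ P , Q , R ⟩) = ⟨ P′ , R + a * P ∸ a * P′ , Q ⟩
    where
    a P′ : ℕ
    a = quotient σ
    P′ = a * Q ∸ P

  -- x > 1 and −1 < x̄ < 0, expressed through s = ⌊√δ⌋.
  record Reduced (σ : State) : Set where
    field
      P≤s     : P σ ≤ s
      s<P+Q   : s < P σ + Q σ
      Q≤P+s   : Q σ ≤ P σ + s
      QR+P²≡δ : Q σ * R σ + P σ * P σ ≡ δ
  open Reduced

  reduced⇒Q≢0 : ∀ {σ} → Reduced σ → NonZero (Q σ)
  reduced⇒Q≢0 {⟨ P , zero , R ⟩} r = contradiction (s<P+Q r) (≤⇒≯ (subst (_≤ s) (sym (+-identityʳ P)) (P≤s r)))
  reduced⇒Q≢0 {⟨ P , suc q , R ⟩} r = _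

  quotient-bounds : ∀ {σ} → Reduced σ →
                    1 ≤ quotient σ × quotient σ * Q σ ≤ P σ + s × P σ + s < quotient σ * Q σ + Q σ
  quotient-bounds {⟨ P , zero , R ⟩} r = ⊥-elim (≢-nonZero⁻¹ 0 {{reduced⇒Q≢0 r}} refl)
  quotient-bounds {⟨ P , suc q , R ⟩} r = m≥n⇒m/n>0 (Q≤P+s r) , m/n*n≤m (P + s) (suc q) , (begin-strict
    P + s                                      ≡⟨ m≡m%n+[m/n]*n (P + s) (suc q) ⟩
    (P + s) % suc q + (P + s) / suc q * suc q  <⟨ +-monoˡ-< _ (m%n<n (P + s) (suc q)) ⟩
    suc q + (P + s) / suc q * suc q            ≡⟨ +-comm (suc q) _ ⟩
    (P + s) / suc q * suc q + suc q            ∎)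
    where open ≤-Reasoning

  step-P′+P≡aQ : ∀ {σ} → Reduced σ → P (step σ) + P σ ≡ quotient σ * Q σ
  step-P′+P≡aQ {σ@(⟨ P , Q , R ⟩)} r = m∸n+n≡m P≤aQ
    where
    a : ℕ
    a = quotient σ
    P≤aQ : P ≤ a * Q
    P≤aQ with Q ≤? s | quotient-bounds r
    ... | yes Q≤s | 1≤a , _ , P+s<aQ+Q = +-cancelʳ-≤ Q P (a * Q) (<⇒≤ (≤-<-trans (+-monoʳ-≤ P Q≤s) P+s<aQ+Q))
    ... | no  Q≰s | 1≤a , _ , _ = ≤-trans (P≤s r) (≤-trans (<⇒≤ (≰⇒> Q≰s)) (m≤n*m Q a {{>-nonZero 1≤a}}))

  step-P′≤s : ∀ {σ} → Reduced σ → P (step σ) ≤ s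
  step-P′≤s {σ} r = +-cancelʳ-≤ (P σ) (P (step σ)) s (begin
    P (step σ) + P σ  ≡⟨ step-P′+P≡aQ r ⟩
    quotient σ * Q σ  ≤⟨ proj₁ (proj₂ (quotient-bounds r)) ⟩
    P σ + s           ≡⟨ +-comm (P σ) s ⟩
    s + P σ           ∎)
    where open ≤-Reasoning

  step-Q′+aP′≡R+aP : ∀ {σ} → Reduced σ → Q (step σ) + quotient σ * P (step σ) ≡ R σ + quotient σ * P σ
  step-Q′+aP′≡R+aP {σ} r =
    m∸n+n≡m (aP′≤R+aP {P = P σ} {Q σ} {R σ} {quotient σ} {{reduced⇒Q≢0 r}} (step-P′+P≡aQ r) (QR+P²≡δ r) P′²≤δ)
    where
    P′²≤δ : P (step σ) * P (step σ) ≤ δ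
    P′²≤δ = ≤-trans (*-mono-≤ (step-P′≤s r) (step-P′≤s r)) (<⇒≤ s²<δ)

  step-Q′Q+P′²≡δ : ∀ {σ} → Reduced σ → Q (step σ) * Q σ + P (step σ) * P (step σ) ≡ δ
  step-Q′Q+P′²≡δ {σ} r =
    QR+P²≡δ⇒Q′Q+P′²≡δ {P = P σ} {Q σ} {R σ} {quotient σ} (step-P′+P≡aQ r) (step-Q′+aP′≡R+aP r) (QR+P²≡δ r)

  reduced-step : ∀ {σ} → Reduced σ → Reduced (step σ)
  reduced-step {σ} r = record
    { P≤s = step-P′≤s r
    ; s<P+Q = ≰⇒> (λ P′+Q′≤s → <⇒≱ s²<δ (begin
        δ                        ≡⟨ step-Q′Q+P′²≡δ r ⟨
        Q′ * Q σ + P′ * P′       ≤⟨ +-monoˡ-≤ (P′ * P′) (*-monoʳ-≤ Q′ (≤-trans Q≤P′+s (≤-reflexive (+-comm P′ s)))) ⟩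
        Q′ * (s + P′) + P′ * P′  ≤⟨ m+n≤k⇒n*[k+m]+m*m≤k*k {P′} {Q′} P′+Q′≤s ⟩
        s * s                    ∎))
    ; Q≤P+s = ≮⇒≥ (λ P′+s<Q′ → <⇒≱ δ<[1+s]² (begin
        suc s * suc s       ≤⟨ m≤k<m+q∧m+k<q′⇒[1+k]²≤q′*q+m*m (step-P′≤s r) s<P′+Q P′+s<Q′ ⟩
        Q′ * Q σ + P′ * P′  ≡⟨ step-Q′Q+P′²≡δ r ⟩
        δ                   ∎))
    ; QR+P²≡δ = step-Q′Q+P′²≡δ r
    }
    where
    open ≤-Reasoning
    P′ Q′ : ℕ
    P′ = P (step σ)
    Q′ = Q (step σ)
    bounds : 1 ≤ quotient σ × quotient σ * Q σ ≤ P σ + s × P σ + s < quotient σ * Q σ + Q σ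
    bounds = quotient-bounds r
    Q≤P′+s : Q σ ≤ P′ + s
    Q≤P′+s = begin
      Q σ               ≤⟨ m≤n*m (Q σ) (quotient σ) {{>-nonZero (proj₁ bounds)}} ⟩
      quotient σ * Q σ  ≡⟨ step-P′+P≡aQ r ⟨
      P′ + P σ          ≤⟨ +-monoʳ-≤ P′ (P≤s r) ⟩
      P′ + s            ∎
    s<P′+Q : s < P′ + Q σ
    s<P′+Q = +-cancelˡ-< (P σ) s (P′ + Q σ) (begin-strict
      P σ + s                 <⟨ proj₂ (proj₂ bounds) ⟩
      quotient σ * Q σ + Q σ  ≡⟨ cong (_+ Q σ) (step-P′+P≡aQ r) ⟨
      P′ + P σ + Q σ          ≡⟨ trans (cong (_+ Q σ) (+-comm P′ (P σ))) (+-assoc (P σ) P′ (Q σ)) ⟩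
      P σ + (P′ + Q σ)        ∎)

  reduced-≡ : ∀ {σ τ} → Reduced σ → Reduced τ → P σ ≡ P τ → Q σ ≡ Q τ → σ ≡ τ
  reduced-≡ {⟨ P , Q , R ⟩} {⟨ _ , _ , R′ ⟩} r t refl refl =
    cong ⟨ P , Q ,_⟩ (*-cancelˡ-≡ R R′ Q {{reduced⇒Q≢0 r}} (+-cancelʳ-≡ (P * P) _ _ (trans (QR+P²≡δ r) (sym (QR+P²≡δ t)))))

  -- step σ determines Q σ, and P σ is the only number in (s − Q σ, s] congruent to −P′ modulo Q σ.
  step-injective : ∀ {σ τ} → Reduced σ → Reduced τ → step σ ≡ step τ → σ ≡ τ
  step-injective {σ} {τ} r t stepσ≡stepτ = reduced-≡ r t Pσ≡Pτ Qσ≡Qτ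
    where
    Qσ≡Qτ : Q σ ≡ Q τ
    Qσ≡Qτ = cong R stepσ≡stepτ
    Pσ≡Pτ : P σ ≡ P τ
    Pσ≡Pτ = x+y≡a*q∧x+y′≡a′*q⇒y≡y′ {a = quotient σ} {quotient τ}
      (P≤s r) (s<P+Q r) (P≤s t) (subst (λ q → s < P τ + q) (sym Qσ≡Qτ) (s<P+Q t))
      (step-P′+P≡aQ r) (trans (cong (λ σ′ → P σ′ + P τ) stepσ≡stepτ) (trans (step-P′+P≡aQ t) (cong (quotient τ *_) (sym Qσ≡Qτ))))

  code : ∀ {σ} → Reduced σ → Fin (suc s * suc (s + s))
  code r = Fin.combine (Fin.fromℕ< (s≤s (P≤s r))) (Fin.fromℕ< (s≤s (≤-trans (Q≤P+s r) (+-monoˡ-≤ s (P≤s r)))))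

  code-injective : ∀ {σ τ} (r : Reduced σ) (t : Reduced τ) → code r ≡ code t → σ ≡ τ
  code-injective r t same-code with Fin.combine-injective _ _ _ _ same-code
  ... | P-codes , Q-codes = reduced-≡ r t (Fin.fromℕ<-injective _ _ _ _ P-codes) (Fin.fromℕ<-injective _ _ _ _ Q-codes)

  σ₀ : State
  σ₀ = ⟨ s , 1 , δ ∸ s * s ⟩

  reduced-σ₀ : Reduced σ₀
  reduced-σ₀ = record
    { P≤s = ≤-refl
    ; s<P+Q = m<m+n s (s≤s z≤n)
    ; Q≤P+s = ≤-trans 1≤s (m≤m+n s s)
    ; QR+P²≡δ = trans (cong (_+ s * s) (*-identityˡ _)) (m∸n+n≡m (<⇒≤ s²<δ))
    }

  σ₀-recurs : ∃[ d ] fold σ₀ step (suc d) ≡ σ₀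
  σ₀-recurs = orbit-periodic step reduced-step step-injective code code-injective reduced-σ₀

  -- The matrix [[p, p₋], [q, q₋]] of two consecutive convergents p/q and p₋/q₋.
  record Convergents : Set where
    constructor conv
    field
      p p₋ q q₋ : ℕ
  open Convergents

  advance : ℕ → Convergents → Convergents
  advance a (conv p p₋ q q₋) = conv (p * a + p₋) p (q * a + q₋) q

  Unimodular : Convergents → Set
  Unimodular M = p M * q₋ M ≡ p₋ M * q M + 1 ⊎ p₋ M * q M ≡ p M * q₋ M + 1

  unimodular-advance : ∀ a {M} → Unimodular M → Unimodular (advance a M)
  unimodular-advance a {conv p p₋ q q₋} (inj₁ pq₋≡p₋q+1) = inj₂ (begin
    p * (q * a + q₋)          ≡⟨ ℕ-Solver.solve (p ∷ q ∷ a ∷ q₋ ∷ []) ⟩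
    p * q * a + p * q₋        ≡⟨ cong (λ y → p * q * a + y) pq₋≡p₋q+1 ⟩
    p * q * a + (p₋ * q + 1)  ≡⟨ ℕ-Solver.solve (p ∷ q ∷ a ∷ p₋ ∷ []) ⟩
    (p * a + p₋) * q + 1      ∎)
    where open ≡-Reasoning
  unimodular-advance a {conv p p₋ q q₋} (inj₂ p₋q≡pq₋+1) = inj₁ (begin
    (p * a + p₋) * q          ≡⟨ ℕ-Solver.solve (p ∷ q ∷ a ∷ p₋ ∷ []) ⟩
    p * q * a + p₋ * q        ≡⟨ cong (λ y → p * q * a + y) p₋q≡pq₋+1 ⟩
    p * q * a + (p * q₋ + 1)  ≡⟨ ℕ-Solver.solve (p ∷ q ∷ a ∷ q₋ ∷ []) ⟩
    p * (q * a + q₋) + 1      ∎)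
    where open ≡-Reasoning

  states : ℕ → State
  states k = fold σ₀ step k

  convergents : ℕ → Convergents
  convergents zero = conv 1 0 0 1
  convergents (suc k) = advance (quotient (states k)) (convergents k)

  reduced-states : ∀ k → Reduced (states k)
  reduced-states zero = reduced-σ₀
  reduced-states (suc k) = reduced-step (reduced-states k)

  unimodular-convergents : ∀ k → Unimodular (convergents k)
  unimodular-convergents zero = inj₁ refl
  unimodular-convergents (suc k) = unimodular-advance _ {convergents k} (unimodular-convergents k)

  1≤q : ∀ k → 1 ≤ q (convergents (suc k))
  1≤q zero = ≤-refl
  1≤q (suc k) = ≤-trans (1≤q k) (≤-trans (m≤m*n _ _ {{>-nonZero (proj₁ (quotient-bounds (reduced-states (suc k))))}}) (m≤m+n _ _))

  α : Zδ
  α = ℕ√ s 1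

  ξ : State → Zδ
  ξ σ = ℕ√ (P σ) 1

  ⟪_,_⟫ : ℕ → ℕ → State → Zδ
  ⟪ x , x₋ ⟫ σ = ιₙ x ⊗ ξ σ ⊕ ιₙ x₋ ⊗ ιₙ (Q σ)

  -- α = (p x + p₋)/(q x + q₋) for the complete quotient x = ξ σ / Q σ, with denominators cleared.
  Expands : Convergents → State → Set
  Expands M σ = α ⊗ ⟪ q M , q₋ M ⟫ σ ≡ ⟪ p M , p₋ M ⟫ σ

  ξ-step-identity : ∀ {P P′ Q Q′ a} → P′ + P ≡ a * Q → Q′ * Q + P′ * P′ ≡ δ →
                    ℕ√ P 1 ⊗ ℕ√ P′ 1 ≡ ιₙ a ⊗ ιₙ Q ⊗ ℕ√ P′ 1 ⊕ ιₙ Q ⊗ ιₙ Q′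
  ξ-step-identity {P} {P′} {Q} {Q′} {a} P′+P≡aQ Q′Q+P′²≡δ = begin
    ℕ√ P 1 ⊗ ℕ√ P′ 1                           ≡⟨ ℕ√-⊗ P 1 P′ 1 ⟩
    ℕ√ (P * P′ + δ * 1) (P * 1 + 1 * P′)       ≡⟨ cong₂ ℕ√ re-eq im-eq ⟩
    ℕ√ (a * Q * P′ + Q * Q′) (a * Q * 1 + 0)   ≡⟨ ℕ√-⊕ (a * Q * P′) (a * Q * 1) (Q * Q′) 0 ⟨
    ℕ√ (a * Q * P′) (a * Q * 1) ⊕ ιₙ (Q * Q′)  ≡⟨ cong₂ _⊕_ (ιₙ-⊗-ℕ√ (a * Q) P′ 1) (sym (ιₙ-* Q Q′)) ⟨
    ιₙ (a * Q) ⊗ ℕ√ P′ 1 ⊕ ιₙ Q ⊗ ιₙ Q′        ≡⟨ cong (λ z → z ⊗ ℕ√ P′ 1 ⊕ ιₙ Q ⊗ ιₙ Q′) (ιₙ-* a Q) ⟩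
    ιₙ a ⊗ ιₙ Q ⊗ ℕ√ P′ 1 ⊕ ιₙ Q ⊗ ιₙ Q′       ∎
    where
    open ≡-Reasoning
    re-eq : P * P′ + δ * 1 ≡ a * Q * P′ + Q * Q′
    re-eq = begin
      P * P′ + δ * 1                   ≡⟨ cong (λ d → P * P′ + d * 1) Q′Q+P′²≡δ ⟨
      P * P′ + (Q′ * Q + P′ * P′) * 1  ≡⟨ ℕ-Solver.solve (P ∷ P′ ∷ Q′ ∷ Q ∷ []) ⟩
      P′ * (P′ + P) + Q * Q′           ≡⟨ cong (λ x → P′ * x + Q * Q′) P′+P≡aQ ⟩
      P′ * (a * Q) + Q * Q′            ≡⟨ ℕ-Solver.solve (P′ ∷ a ∷ Q ∷ Q′ ∷ []) ⟩
      a * Q * P′ + Q * Q′              ∎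
    im-eq : P * 1 + 1 * P′ ≡ a * Q * 1 + 0
    im-eq = begin
      P * 1 + 1 * P′    ≡⟨ ℕ-Solver.solve (P ∷ P′ ∷ []) ⟩
      (P′ + P) * 1 + 0  ≡⟨ cong (λ x → x * 1 + 0) P′+P≡aQ ⟩
      a * Q * 1 + 0     ∎

  shift-identity : ∀ ξ ξ′ Q Q′ a x x₋ → ξ ⊗ ξ′ ≡ a ⊗ Q ⊗ ξ′ ⊕ Q ⊗ Q′ →
                   Q ⊗ ((x ⊗ a ⊕ x₋) ⊗ ξ′ ⊕ x ⊗ Q′) ≡ ξ′ ⊗ (x ⊗ ξ ⊕ x₋ ⊗ Q)
  shift-identity ξ ξ′ Q Q′ a x x₋ ξξ′≡aQξ′+QQ′ = begin
    Q ⊗ ((x ⊗ a ⊕ x₋) ⊗ ξ′ ⊕ x ⊗ Q′)     ≡⟨ solve 6 (λ ξ′ Q Q′ a x x₋ → Q :* ((x :* a :+ x₋) :* ξ′ :+ x :* Q′)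
                                                     := x :* (a :* Q :* ξ′ :+ Q :* Q′) :+ x₋ :* Q :* ξ′) refl ξ′ Q Q′ a x x₋ ⟩
    x ⊗ (a ⊗ Q ⊗ ξ′ ⊕ Q ⊗ Q′) ⊕ x₋ ⊗ Q ⊗ ξ′  ≡⟨ cong (λ z → x ⊗ z ⊕ x₋ ⊗ Q ⊗ ξ′) ξξ′≡aQξ′+QQ′ ⟨
    x ⊗ (ξ ⊗ ξ′) ⊕ x₋ ⊗ Q ⊗ ξ′               ≡⟨ solve 5 (λ ξ ξ′ Q x x₋ → x :* (ξ :* ξ′) :+ x₋ :* Q :* ξ′
                                                        := ξ′ :* (x :* ξ :+ x₋ :* Q)) refl ξ ξ′ Q x x₋ ⟩
    ξ′ ⊗ (x ⊗ ξ ⊕ x₋ ⊗ Q)                    ∎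
    where open ≡-Reasoning

  ⟪⟫-advance : ∀ {σ} → Reduced σ → ∀ x x₋ →
               ιₙ (Q σ) ⊗ ⟪ x * quotient σ + x₋ , x ⟫ (step σ) ≡ ξ (step σ) ⊗ ⟪ x , x₋ ⟫ σ
  ⟪⟫-advance {σ} r x x₋ = begin
    ιₙ (Q σ) ⊗ (ιₙ (x * a + x₋) ⊗ ξ′ ⊕ ιₙ x ⊗ ιₙ Q′)         ≡⟨ cong (λ z → ιₙ (Q σ) ⊗ (z ⊗ ξ′ ⊕ ιₙ x ⊗ ιₙ Q′)) ιₙ[xa+x₋] ⟩
    ιₙ (Q σ) ⊗ ((ιₙ x ⊗ ιₙ a ⊕ ιₙ x₋) ⊗ ξ′ ⊕ ιₙ x ⊗ ιₙ Q′)   ≡⟨ shift-identity (ξ σ) ξ′ (ιₙ (Q σ)) (ιₙ Q′) (ιₙ a) (ιₙ x) (ιₙ x₋) ξξ′ ⟩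
    ξ′ ⊗ (ιₙ x ⊗ ξ σ ⊕ ιₙ x₋ ⊗ ιₙ (Q σ))                    ∎
    where
    open ≡-Reasoning
    a Q′ : ℕ
    a = quotient σ
    Q′ = Q (step σ)
    ξ′ : Zδ
    ξ′ = ξ (step σ)
    ιₙ[xa+x₋] : ιₙ (x * a + x₋) ≡ ιₙ x ⊗ ιₙ a ⊕ ιₙ x₋
    ιₙ[xa+x₋] = trans (ιₙ-+ (x * a) x₋) (cong (_⊕ ιₙ x₋) (ιₙ-* x a))
    ξξ′ : ξ σ ⊗ ξ′ ≡ ιₙ a ⊗ ιₙ (Q σ) ⊗ ξ′ ⊕ ιₙ (Q σ) ⊗ ιₙ Q′
    ξξ′ = ξ-step-identity {P σ} {P (step σ)} {Q σ} {Q′} {a} (step-P′+P≡aQ r) (step-Q′Q+P′²≡δ r)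

  expands-step : ∀ {M σ} → Reduced σ → Expands M σ → Expands (advance (quotient σ) M) (step σ)
  expands-step {conv p p₋ q q₋} {σ} r α⟪q⟫≡⟪p⟫ = ⊗-cancelˡ-if-regular {ιₙ (Q σ)} (ι-⊗-cancel _ Q≢0) (begin
    ιₙ (Q σ) ⊗ (α ⊗ ⟪ q * a + q₋ , q ⟫ (step σ))  ≡⟨ x⊗[y⊗z]≡y⊗[x⊗z] (ιₙ (Q σ)) α _ ⟩
    α ⊗ (ιₙ (Q σ) ⊗ ⟪ q * a + q₋ , q ⟫ (step σ))  ≡⟨ cong (α ⊗_) (⟪⟫-advance r q q₋) ⟩
    α ⊗ (ξ (step σ) ⊗ ⟪ q , q₋ ⟫ σ)               ≡⟨ x⊗[y⊗z]≡y⊗[x⊗z] α (ξ (step σ)) _ ⟩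
    ξ (step σ) ⊗ (α ⊗ ⟪ q , q₋ ⟫ σ)               ≡⟨ cong (ξ (step σ) ⊗_) α⟪q⟫≡⟪p⟫ ⟩
    ξ (step σ) ⊗ ⟪ p , p₋ ⟫ σ                     ≡⟨ ⟪⟫-advance r p p₋ ⟨
    ιₙ (Q σ) ⊗ ⟪ p * a + p₋ , p ⟫ (step σ)        ∎)
    where
    open ≡-Reasoning
    a : ℕ
    a = quotient σ
    Q≢0 : + Q σ ≢ + 0
    Q≢0 eq = ≢-nonZero⁻¹ (Q σ) {{reduced⇒Q≢0 r}} (ℤ.+-injective eq)

  expands : ∀ k → Expands (convergents k) (states k)
  expands zero = solve 1 (λ α → α :* (con (+ 0) :* α :+ con (+ 1) :* con (+ 1)) := con (+ 1) :* α :+ con (+ 0) :* con (+ 1)) refl α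
  expands (suc k) = expands-step {convergents k} (reduced-states k) (expands k)

  ⟪⟫-ℕ√ : ∀ x x₋ σ → ⟪ x , x₋ ⟫ σ ≡ ℕ√ (x * P σ + x₋ * Q σ) x
  ⟪⟫-ℕ√ x x₋ σ = begin
    ιₙ x ⊗ ℕ√ (P σ) 1 ⊕ ιₙ x₋ ⊗ ιₙ (Q σ)           ≡⟨ cong₂ _⊕_ (ιₙ-⊗-ℕ√ x (P σ) 1) (ιₙ-⊗-ℕ√ x₋ (Q σ) 0) ⟩
    ℕ√ (x * P σ) (x * 1) ⊕ ℕ√ (x₋ * Q σ) (x₋ * 0)  ≡⟨ ℕ√-⊕ (x * P σ) (x * 1) (x₋ * Q σ) (x₋ * 0) ⟩
    ℕ√ (x * P σ + x₋ * Q σ) (x * 1 + x₋ * 0)       ≡⟨ cong (ℕ√ _) (ℕ-Solver.solve (x ∷ x₋ ∷ [])) ⟩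
    ℕ√ (x * P σ + x₋ * Q σ) x                      ∎
    where open ≡-Reasoning

  fixed-point-equations : ∀ p p₋ q q₋ → Expands (conv p p₋ q q₋) σ₀ →
                          s * q + (q * s + q₋) ≡ p × s * (q * s + q₋) + δ * q ≡ p * s + p₋
  fixed-point-equations p p₋ q q₋ α⟪q⟫≡⟪p⟫ = im-eq , re-eq
    where
    open ≡-Reasoning
    components : ℕ√ (s * (q * s + q₋ * 1) + δ * (1 * q)) (s * q + 1 * (q * s + q₋ * 1)) ≡ ℕ√ (p * s + p₋ * 1) p
    components = begin
      ℕ√ (s * (q * s + q₋ * 1) + δ * (1 * q)) (s * q + 1 * (q * s + q₋ * 1))  ≡⟨ ℕ√-⊗ s 1 (q * s + q₋ * 1) q ⟨
      α ⊗ ℕ√ (q * s + q₋ * 1) q                                               ≡⟨ cong (α ⊗_) (⟪⟫-ℕ√ q q₋ σ₀) ⟨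
      α ⊗ ⟪ q , q₋ ⟫ σ₀                                                       ≡⟨ α⟪q⟫≡⟪p⟫ ⟩
      ⟪ p , p₋ ⟫ σ₀                                                           ≡⟨ ⟪⟫-ℕ√ p p₋ σ₀ ⟩
      ℕ√ (p * s + p₋ * 1) p                                                   ∎
    im-eq : s * q + (q * s + q₋) ≡ p
    im-eq = begin
      s * q + (q * s + q₋)          ≡⟨ ℕ-Solver.solve (s ∷ q ∷ q₋ ∷ []) ⟩
      s * q + 1 * (q * s + q₋ * 1)  ≡⟨ proj₂ (ℕ√-injective components) ⟩
      p                             ∎
    re-eq : s * (q * s + q₋) + δ * q ≡ p * s + p₋
    re-eq = begin
      s * (q * s + q₋) + δ * q            ≡⟨ ℕ-Solver.solve (s ∷ q ∷ q₋ ∷ δ ∷ []) ⟩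
      s * (q * s + q₋ * 1) + δ * (1 * q)  ≡⟨ proj₁ (ℕ√-injective components) ⟩
      p * s + p₋ * 1                      ≡⟨ cong (λ y → p * s + y) (*-identityʳ p₋) ⟩
      p * s + p₋                          ∎

  -- Back at σ₀, α is a fixed point of the Möbius map of M, which forces N(q α + q₋) = ±1;
  -- the square of q α + q₋ then solves Pell's equation.
  pell-from-return : ∀ M → 1 ≤ q M → Unimodular M → Expands M σ₀ → ∃[ x ] ∃[ y ] x * x ≡ δ * (y * y) + 1 × 1 ≤ y
  pell-from-return (conv p p₋ q q₋) 1≤q unimodular α⟪q⟫≡⟪p⟫ =
    X * X + δ * (q * q) , 2 * X * q , square-of-norm-±1 {δ} {X} {q} norm±1 , *-mono-≤ (*-mono-≤ {1} {2} (s≤s z≤n) 1≤X) 1≤q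
    where
    X : ℕ
    X = q * s + q₋
    1≤X : 1 ≤ X
    1≤X = ≤-trans (*-mono-≤ 1≤q 1≤s) (m≤m+n (q * s) q₋)
    norm : X * X + p₋ * q ≡ δ * (q * q) + p * q₋
    norm = fixed-point-norm {δ} {s} {p} {p₋} {q} {q₋} (proj₁ equations) (proj₂ equations)
      where equations = fixed-point-equations p p₋ q q₋ α⟪q⟫≡⟪p⟫
    norm±1 : X * X ≡ δ * (q * q) + 1 ⊎ δ * (q * q) ≡ X * X + 1
    norm±1 = a+b≡d+c∧c≡b±1⇒a≡d±1 {X * X} {p₋ * q} {p * q₋} {δ * (q * q)} norm unimodular

  pell : ∃[ x ] ∃[ y ] x * x ≡ δ * (y * y) + 1 × 1 ≤ y
  pell = pell-from-return (convergents (suc d)) (1≤q d) (unimodular-convergents (suc d))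
                          (subst (Expands (convergents (suc d))) states[1+d]≡σ₀ (expands (suc d)))
    where
    d : ℕ
    d = proj₁ σ₀-recurs
    states[1+d]≡σ₀ : states (suc d) ≡ σ₀
    states[1+d]≡σ₀ = proj₂ σ₀-recurs

-- Opaque: only the existence of a solution is used, and unfolding the search makes type checking blow up.
opaque
  pell-solvable : ∀ {δ} → ¬ IsSquare δ → ∃[ x ] ∃[ y ] x * x ≡ δ * (y * y) + 1 × 1 ≤ y
  pell-solvable {δ} δ-nonsquare with integer-sqrt δ
  ... | s , s²≤δ , δ<[1+s]² = ContinuedFraction.pell {δ} {s} 1≤s s²<δ δ<[1+s]²
    where
    1≤s : 1 ≤ s
    1≤s = nonsquare∧δ<[1+s]²⇒1≤s δ-nonsquare δ<[1+s]²
    s²<δ : s * s < δ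
    s²<δ = ≤∧≢⇒< s²≤δ (λ s²≡δ → δ-nonsquare (s , s²≡δ))

module PellUnits {δ : ℕ} (δ-nonsquare : ¬ IsSquare δ) where
  open ℤ√ δ

  private
    solution : ∃[ x ] ∃[ y ] x * x ≡ δ * (y * y) + 1 × 1 ≤ y
    solution = pell-solvable δ-nonsquare

  x₀ y₀ : ℕ
  x₀ = proj₁ solution
  y₀ = proj₁ (proj₂ solution)

  ε : Zδ
  ε = ℕ√ x₀ y₀

  A B : ℕ → ℕ
  A zero = 1
  A (suc n) = x₀ * A n + δ * (y₀ * B n)
  B zero = 0
  B (suc n) = x₀ * B n + y₀ * A n

  ε^n≡ℕ√[An,Bn] : ∀ n → ε ^ n ≡ ℕ√ (A n) (B n)
  ε^n≡ℕ√[An,Bn] zero = refl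
  ε^n≡ℕ√[An,Bn] (suc n) = trans (cong (ε ⊗_) (ε^n≡ℕ√[An,Bn] n)) (ℕ√-⊗ x₀ y₀ (A n) (B n))

  N-ε^ : ∀ n → N (ε ^ n) ≡ + 1
  N-ε^ n = N-^ ε n (pell⇒N-ℕ√≡1 {x₀} {y₀} (proj₁ (proj₂ (proj₂ solution))))

  A²≡δB²+1 : ∀ n → A n * A n ≡ δ * (B n * B n) + 1
  A²≡δB²+1 n = N-ℕ√≡1⇒pell {A n} {B n} (trans (cong N (sym (ε^n≡ℕ√[An,Bn] n))) (N-ε^ n))

  B-increasing : ∀ n → B n < B (suc n)
  B-increasing n = ≤-trans (≤-reflexive (+-comm 1 (B n)))
    (+-mono-≤ (m≤n*m (B n) x₀ {{>-nonZero 1≤x₀}}) (*-mono-≤ 1≤y₀ (x*x≡y+1⇒1≤x {A n} (A²≡δB²+1 n))))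
    where
    1≤x₀ : 1 ≤ x₀
    1≤x₀ = x*x≡y+1⇒1≤x {x₀} (proj₁ (proj₂ (proj₂ solution)))
    1≤y₀ : 1 ≤ y₀
    1≤y₀ = proj₂ (proj₂ (proj₂ solution))

  B-injective : ∀ {m n} → B m ≡ B n → m ≡ n
  B-injective = increasing⇒injective B B-increasing

  ε^-injective : ∀ {i j} → ε ^ i ≡ ε ^ j → i ≡ j
  ε^-injective {i} {j} ε^i≡ε^j = B-injective (proj₂ (ℕ√-injective (trans (sym (ε^n≡ℕ√[An,Bn] i)) (trans ε^i≡ε^j (ε^n≡ℕ√[An,Bn] j)))))

  conj-ε^⊗ε^≡𝟙 : ∀ k → conj (ε ^ k) ⊗ ε ^ k ≡ 𝟙
  conj-ε^⊗ε^≡𝟙 k = trans (conj-⊗ (ε ^ k)) (cong ι (N-ε^ k))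

-- Zariski density

module Polynomials {δ : ℕ} (δ-nonsquare : ¬ IsSquare δ) where
  open ℤ√ δ
  open ℤ√-Domain δ-nonsquare
  open PolynomialFunctions ⊕-⊗-isCommutativeRing public
    using (DegreeBelow; degreeBelow-ext; degreeBelow-zero; degreeBelow-const; degreeBelow-id; degreeBelow-suc;
           degreeBelow-mono; degreeBelow-⊕; degreeBelow-scale; degreeBelow-⊗)
  open PolynomialFunctions ⊕-⊗-isCommutativeRing using (degreeBelow-roots⇒𝟘)

  roots⇒≗𝟘 : ∀ {n F} → DegreeBelow n F → (p : Fin n → Zδ) → (∀ {i j} → p i ≡ p j → i ≡ j) →
               (∀ i → F (p i) ≡ 𝟘) → ∀ x → F x ≡ 𝟘
  roots⇒≗𝟘 = degreeBelow-roots⇒𝟘 x≢𝟘∧x⊗y≡𝟘⇒y≡𝟘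

  degreeBelow-affine : ∀ α β → DegreeBelow 2 (λ t → α ⊕ β ⊗ t)
  degreeBelow-affine α β = degreeBelow-⊕ 2 (degreeBelow-suc 1 (degreeBelow-const α)) (degreeBelow-scale 2 β degreeBelow-id)

  degreeBelow-shift : ∀ α → DegreeBelow 2 (λ t → α ⊕ t)
  degreeBelow-shift α = degreeBelow-⊕ 2 (degreeBelow-suc 1 (degreeBelow-const α)) degreeBelow-id

  degreeBelow-^ : ∀ i {F} → DegreeBelow 2 F → DegreeBelow (suc i) (λ x → F x ^ i)
  degreeBelow-^ zero degF = degreeBelow-const 𝟙
  degreeBelow-^ (suc i) degF = degreeBelow-⊗ 1 i degF (degreeBelow-^ i degF)

  degreeBelow-Σᶠ : ∀ d k (f : Fin k → Zδ → Zδ) → (∀ i → DegreeBelow d (f i)) → DegreeBelow d (λ x → Σᶠ k (λ i → f i x))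
  degreeBelow-Σᶠ d zero f deg-f = degreeBelow-zero d
  degreeBelow-Σᶠ d (suc k) f deg-f = degreeBelow-⊕ d (deg-f Fin.zero) (degreeBelow-Σᶠ d k (f ∘ Fin.suc) (deg-f ∘ Fin.suc))

  degreeBelow-eval : ∀ n (c : Poly2 n) {X Y} → DegreeBelow 2 X → DegreeBelow 2 Y → DegreeBelow (n + n) (λ t → eval c (X t) (Y t))
  degreeBelow-eval n c degX degY =
    degreeBelow-Σᶠ (n + n) n _ λ i → degreeBelow-Σᶠ (n + n) n _ λ j →
      degreeBelow-scale (n + n) (c i j)
        (degreeBelow-mono (+-mono-≤ (Fin.toℕ<n i) (<⇒≤ (Fin.toℕ<n j)))
          (degreeBelow-⊗ (toℕ i) (toℕ j) (degreeBelow-^ (toℕ i) degX) (degreeBelow-^ (toℕ j) degY)))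

  Σᶠ-cong : ∀ n {f g : Fin n → Zδ} → (∀ i → f i ≡ g i) → Σᶠ n f ≡ Σᶠ n g
  Σᶠ-cong zero f≗g = refl
  Σᶠ-cong (suc n) f≗g = cong₂ _⊕_ (f≗g Fin.zero) (Σᶠ-cong n (f≗g ∘ Fin.suc))

  ⊗-distribˡ-Σᶠ : ∀ n x (f : Fin n → Zδ) → x ⊗ Σᶠ n f ≡ Σᶠ n (λ i → x ⊗ f i)
  ⊗-distribˡ-Σᶠ zero x f = ⊗-zeroʳ x
  ⊗-distribˡ-Σᶠ (suc n) x f = trans (⊗-distribˡ-⊕ x _ _) (cong (x ⊗ f Fin.zero ⊕_) (⊗-distribˡ-Σᶠ n x (f ∘ Fin.suc)))

  horner : ∀ n (u : Fin (suc n) → Zδ) x →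
           Σᶠ (suc n) (λ i → u i ⊗ x ^ toℕ i) ≡ u Fin.zero ⊗ 𝟙 ⊕ x ⊗ Σᶠ n (λ i → u (Fin.suc i) ⊗ x ^ toℕ i)
  horner n u x = cong (u Fin.zero ⊗ 𝟙 ⊕_) (sym (trans (⊗-distribˡ-Σᶠ n x _) (Σᶠ-cong n (λ i → x⊗[y⊗z]≡y⊗[x⊗z] x (u (Fin.suc i)) _))))

  polynomial≗𝟘⇒coefficients≡𝟘 : ∀ n (u : Fin n → Zδ) → (∀ x → Σᶠ n (λ i → u i ⊗ x ^ toℕ i) ≡ 𝟘) → ∀ i → u i ≡ 𝟘
  polynomial≗𝟘⇒coefficients≡𝟘 (suc n) u vanishes Fin.zero = begin
    u Fin.zero                          ≡⟨ solve 2 (λ u t → u := u :* con (+ 1) :+ con (+ 0) :* t) refl (u Fin.zero) tail₀ ⟩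
    u Fin.zero ⊗ 𝟙 ⊕ 𝟘 ⊗ tail₀          ≡⟨ horner n u 𝟘 ⟨
    Σᶠ (suc n) (λ i → u i ⊗ 𝟘 ^ toℕ i)  ≡⟨ vanishes 𝟘 ⟩
    𝟘                                   ∎
    where
    open ≡-Reasoning
    tail₀ : Zδ
    tail₀ = Σᶠ n (λ i → u (Fin.suc i) ⊗ 𝟘 ^ toℕ i)
  polynomial≗𝟘⇒coefficients≡𝟘 (suc n) u vanishes (Fin.suc i) = polynomial≗𝟘⇒coefficients≡𝟘 n (u ∘ Fin.suc) tail-vanishes i
    where
    tail : Zδ → Zδ
    tail x = Σᶠ n (λ i → u (Fin.suc i) ⊗ x ^ toℕ i)
    x⊗tail≡𝟘 : ∀ x → x ⊗ tail x ≡ 𝟘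
    x⊗tail≡𝟘 x = begin
      x ⊗ tail x                          ≡⟨ solve 2 (λ x t → x :* t := con (+ 0) :* con (+ 1) :+ x :* t) refl x (tail x) ⟩
      𝟘 ⊗ 𝟙 ⊕ x ⊗ tail x                  ≡⟨ cong (λ u₀ → u₀ ⊗ 𝟙 ⊕ x ⊗ tail x) (polynomial≗𝟘⇒coefficients≡𝟘 (suc n) u vanishes Fin.zero) ⟨
      u Fin.zero ⊗ 𝟙 ⊕ x ⊗ tail x         ≡⟨ horner n u x ⟨
      Σᶠ (suc n) (λ i → u i ⊗ x ^ toℕ i)  ≡⟨ vanishes x ⟩
      𝟘                                   ∎
      where open ≡-Reasoning
    tail-vanishes : ∀ x → tail x ≡ 𝟘
    tail-vanishes = roots⇒≗𝟘
      (degreeBelow-Σᶠ n n _ λ i → degreeBelow-scale n (u (Fin.suc i)) (degreeBelow-mono (Fin.toℕ<n i) (degreeBelow-^ (toℕ i) degreeBelow-id)))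
      (ιₙ ∘ suc ∘ toℕ) (Fin.toℕ-injective ∘ suc-injective ∘ ιₙ-injective)
      (λ k → x≢𝟘∧x⊗y≡𝟘⇒y≡𝟘 {ιₙ (suc (toℕ k))} (λ ()) (x⊗tail≡𝟘 (ιₙ (suc (toℕ k)))))

  eval≗𝟘⇒coefficients≡𝟘 : ∀ n (c : Poly2 n) → (∀ x y → eval c x y ≡ 𝟘) → ∀ i j → c i j ≡ 𝟘
  eval≗𝟘⇒coefficients≡𝟘 n c vanishes i =
    polynomial≗𝟘⇒coefficients≡𝟘 n (c i) λ y → polynomial≗𝟘⇒coefficients≡𝟘 n (λ i → Σᶠ n (λ j → c i j ⊗ y ^ toℕ j)) (λ x → trans (rearrange x y) (vanishes x y)) i
    where
    rearrange : ∀ x y → Σᶠ n (λ i → Σᶠ n (λ j → c i j ⊗ y ^ toℕ j) ⊗ x ^ toℕ i) ≡ eval c x y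
    rearrange x y = Σᶠ-cong n λ i → trans (⊗-comm _ (x ^ toℕ i)) (trans (⊗-distribˡ-Σᶠ n (x ^ toℕ i) _)
                                      (Σᶠ-cong n λ j → x⊗[y⊗z]≡y⊗[x⊗z] (x ^ toℕ i) (c i j) (y ^ toℕ j)))

  module Pencil (u u⁻¹ : ℕ → Zδ) (u⁻¹⊗u≡𝟙 : ∀ k → u⁻¹ k ⊗ u k ≡ 𝟙) (u-injective : ∀ {i j} → u i ≡ u j → i ≡ j)
                (o₁ o₂ : Zδ) (μ : ℕ → Zδ) (μ-injective : ∀ {i j} → μ i ≡ μ j → i ≡ j)
                (T : ℕ → ℕ → Zδ) (T-injective : ∀ j {k l} → T j k ≡ T j l → k ≡ l) where

    point : ℕ → ℕ → Zδ × Zδ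
    point j k = o₁ ⊕ T j k , o₂ ⊕ μ j ⊗ T j k

    -- The line through (o₁ , o₂) of slope (y ⊖ o₂) ⊗ u⁻¹ k meets the horizontal line at height y
    -- at o₁ ⊕ u k, so x ↦ eval c x y has infinitely many roots.
    vanishing-on-pencil⇒≗𝟘 : ∀ n (c : Poly2 n) → (∀ t ν → eval c (o₁ ⊕ t) (o₂ ⊕ ν ⊗ t) ≡ 𝟘) → ∀ x y → eval c x y ≡ 𝟘
    vanishing-on-pencil⇒≗𝟘 n c vanishes x y =
      roots⇒≗𝟘 (degreeBelow-eval n c degreeBelow-id (degreeBelow-suc 1 (degreeBelow-const y)))
                 (λ k → o₁ ⊕ u (toℕ k)) (Fin.toℕ-injective ∘ u-injective ∘ ⊕-cancelˡ o₁)
                 (λ k → trans (cong (eval c _) (y≡o₂+[y-o₂]u⁻¹u (toℕ k))) (vanishes (u (toℕ k)) ((y ⊖ o₂) ⊗ u⁻¹ (toℕ k))))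
                 x
      where
      y≡o₂+[y-o₂]u⁻¹u : ∀ k → y ≡ o₂ ⊕ ((y ⊖ o₂) ⊗ u⁻¹ k) ⊗ u k
      y≡o₂+[y-o₂]u⁻¹u k = begin
        y                              ≡⟨ solve 2 (λ y o → y := o :+ (y :- o) :* con (+ 1)) refl y o₂ ⟩
        o₂ ⊕ (y ⊖ o₂) ⊗ 𝟙              ≡⟨ cong (λ z → o₂ ⊕ (y ⊖ o₂) ⊗ z) (u⁻¹⊗u≡𝟙 k) ⟨
        o₂ ⊕ (y ⊖ o₂) ⊗ (u⁻¹ k ⊗ u k)  ≡⟨ cong (o₂ ⊕_) (⊗-assoc (y ⊖ o₂) (u⁻¹ k) (u k)) ⟨
        o₂ ⊕ ((y ⊖ o₂) ⊗ u⁻¹ k) ⊗ u k  ∎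
        where open ≡-Reasoning

    vanishing-at-points⇒coefficients≡𝟘 : ∀ n (c : Poly2 n) →
      (∀ (j k : Fin (n + n)) → eval c (proj₁ (point (toℕ j) (toℕ k))) (proj₂ (point (toℕ j) (toℕ k))) ≡ 𝟘) →
      ∀ i j → c i j ≡ 𝟘
    vanishing-at-points⇒coefficients≡𝟘 n c vanishes = eval≗𝟘⇒coefficients≡𝟘 n c (vanishing-on-pencil⇒≗𝟘 n c on-pencil)
      where
      on-line : ∀ (j : Fin (n + n)) t → eval c (o₁ ⊕ t) (o₂ ⊕ μ (toℕ j) ⊗ t) ≡ 𝟘
      on-line j = roots⇒≗𝟘 (degreeBelow-eval n c (degreeBelow-shift o₁) (degreeBelow-affine o₂ (μ (toℕ j))))
                             (T (toℕ j) ∘ toℕ) (Fin.toℕ-injective ∘ T-injective (toℕ j)) (vanishes j)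
      on-pencil : ∀ t ν → eval c (o₁ ⊕ t) (o₂ ⊕ ν ⊗ t) ≡ 𝟘
      on-pencil t = roots⇒≗𝟘
        (degreeBelow-ext (n + n) (λ ν → cong (λ z → eval c (o₁ ⊕ t) (o₂ ⊕ z)) (⊗-comm t ν))
          (degreeBelow-eval n c (degreeBelow-suc 1 (degreeBelow-const (o₁ ⊕ t))) (degreeBelow-affine o₂ t)))
        (μ ∘ toℕ) (Fin.toℕ-injective ∘ μ-injective) (λ j → on-line j t)

    dense : ∀ {S} → (∀ j k → S (point j k)) → Ring.ZariskiDense δ S
    dense {S} in-S n c (i₀ , j₀ , cᵢ₀ⱼ₀≢𝟘) = point (toℕ j) (toℕ k) , in-S (toℕ j) (toℕ k) , proj₂ nonvanishing-point
      where
      Vanishes : Fin (n + n) → Fin (n + n) → Set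
      Vanishes j k = eval c (proj₁ (point (toℕ j) (toℕ k))) (proj₂ (point (toℕ j) (toℕ k))) ≡ 𝟘
      nonvanishing-line : ∃[ j ] ¬ (∀ k → Vanishes j k)
      nonvanishing-line = Fin.¬∀⟶∃¬ (n + n) (λ j → ∀ k → Vanishes j k) (λ j → Fin.all? (λ k → _ ≟ 𝟘))
                                    (λ all-vanish → cᵢ₀ⱼ₀≢𝟘 (vanishing-at-points⇒coefficients≡𝟘 n c all-vanish i₀ j₀))
      j : Fin (n + n)
      j = proj₁ nonvanishing-line
      nonvanishing-point : ∃[ k ] ¬ Vanishes j k
      nonvanishing-point = Fin.¬∀⟶∃¬ (n + n) (Vanishes j) (λ k → _ ≟ 𝟘) (proj₂ nonvanishing-line)
      k : Fin (n + n)
      k = proj₁ nonvanishing-point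

-- The construction

module Geometry {δ : ℕ} where
  open ℤ√ δ

  sqDist-on-line : ∀ o₁ o₂ t μ → sqDist (o₁ , o₂) (ι o₁ ⊕ t , ι o₂ ⊕ μ ⊗ t) ≡ (t ⊗ t) ⊗ (𝟙 ⊕ μ ⊗ μ)
  sqDist-on-line o₁ o₂ t μ =
    solve 4 (λ o₁ o₂ t μ → ((o₁ :+ t) :- o₁) :* ((o₁ :+ t) :- o₁) :+ ((o₂ :+ μ :* t) :- o₂) :* ((o₂ :+ μ :* t) :- o₂)
                           := (t :* t) :* (con (+ 1) :+ μ :* μ)) refl (ι o₁) (ι o₂) t μ

  sqDist-from-line : ∀ o₁ o₂ p₁ p₂ τ μ →
    let d₁ = ι p₁ ⊖ ι o₁ ; g = μ ⊗ d₁ ⊖ (ι p₂ ⊖ ι o₂) in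
    sqDist (p₁ , p₂) (ι o₁ ⊕ (d₁ ⊕ τ) , ι o₂ ⊕ μ ⊗ (d₁ ⊕ τ)) ≡ τ ⊗ τ ⊕ (μ ⊗ τ ⊕ g) ⊗ (μ ⊗ τ ⊕ g)
  sqDist-from-line o₁ o₂ p₁ p₂ τ μ =
    solve 6 (λ o₁ o₂ p₁ p₂ τ μ →
               ((o₁ :+ ((p₁ :- o₁) :+ τ)) :- p₁) :* ((o₁ :+ ((p₁ :- o₁) :+ τ)) :- p₁) :+
               ((o₂ :+ μ :* ((p₁ :- o₁) :+ τ)) :- p₂) :* ((o₂ :+ μ :* ((p₁ :- o₁) :+ τ)) :- p₂)
             := τ :* τ :+ (μ :* τ :+ (μ :* (p₁ :- o₁) :- (p₂ :- o₂))) :* (μ :* τ :+ (μ :* (p₁ :- o₁) :- (p₂ :- o₂))))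
          refl (ι o₁) (ι o₂) (ι p₁) (ι p₂) τ μ

  completing-the-square : ∀ μ W τ g → 𝟙 ⊕ μ ⊗ μ ≡ W →
    W ⊗ (τ ⊗ τ ⊕ (μ ⊗ τ ⊕ g) ⊗ (μ ⊗ τ ⊕ g)) ≡ (W ⊗ τ ⊕ μ ⊗ g) ⊗ (W ⊗ τ ⊕ μ ⊗ g) ⊕ g ⊗ g
  completing-the-square μ W τ g refl =
    solve 3 (λ μ τ g → (con (+ 1) :+ μ :* μ) :* (τ :* τ :+ (μ :* τ :+ g) :* (μ :* τ :+ g))
                     := ((con (+ 1) :+ μ :* μ) :* τ :+ μ :* g) :* ((con (+ 1) :+ μ :* μ) :* τ :+ μ :* g) :+ g :* g) refl μ τ g

  through-point : ∀ μ t → (t ⊗ t) ⊗ (𝟙 ⊕ μ ⊗ μ) ≡ t ⊗ t ⊕ (μ ⊗ t ⊕ 𝟘) ⊗ (μ ⊗ t ⊕ 𝟘)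
  through-point μ t = solve 2 (λ μ t → (t :* t) :* (con (+ 1) :+ μ :* μ) := t :* t :+ (μ :* t :+ con (+ 0)) :* (μ :* t :+ con (+ 0))) refl μ t

  [wt]²≡t²w² : ∀ w t → (w ⊗ t) ⊗ (w ⊗ t) ≡ (t ⊗ t) ⊗ (w ⊗ w)
  [wt]²≡t²w² w t = solve 2 (λ w t → (w :* t) :* (w :* t) := (t :* t) :* (w :* w)) refl w t

  [g[sy]]²+g²≡g²[s²y²+1] : ∀ g s y → (g ⊗ (s ⊗ y)) ⊗ (g ⊗ (s ⊗ y)) ⊕ g ⊗ g ≡ (g ⊗ g) ⊗ ((s ⊗ s) ⊗ (y ⊗ y) ⊕ 𝟙)
  [g[sy]]²+g²≡g²[s²y²+1] g s y =
    solve 3 (λ g s y → (g :* (s :* y)) :* (g :* (s :* y)) :+ g :* g := (g :* g) :* ((s :* s) :* (y :* y) :+ con (+ 1))) refl g s y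

  g²[ac]²≡a²[gc]² : ∀ g a c → (g ⊗ g) ⊗ ((a ⊗ c) ⊗ (a ⊗ c)) ≡ (a ⊗ a) ⊗ ((g ⊗ c) ⊗ (g ⊗ c))
  g²[ac]²≡a²[gc]² g a c = solve 3 (λ g a c → (g :* g) :* ((a :* c) :* (a :* c)) := (a :* a) :* ((g :* c) :* (g :* c))) refl g a c

  W[g[se]]+[sb]g≡g[s[b+We]] : ∀ W g s e b → W ⊗ (g ⊗ (s ⊗ e)) ⊕ (s ⊗ b) ⊗ g ≡ g ⊗ (s ⊗ (b ⊕ W ⊗ e))
  W[g[se]]+[sb]g≡g[s[b+We]] W g s e b =
    solve 5 (λ W g s e b → W :* (g :* (s :* e)) :+ (s :* b) :* g := g :* (s :* (b :+ W :* e))) refl W g s e b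

module Construction {δ : ℕ} (δ-nonsquare : ¬ IsSquare δ) (o₁ o₂ p₁ p₂ : ℤ) where
  open ℤ√ δ
  open ℤ√-Domain δ-nonsquare
  open PellUnits δ-nonsquare
  open Geometry {δ}

  d₁ : Zδ
  d₁ = ι p₁ ⊖ ι o₁

  offset : Zδ → Zδ
  offset μ = μ ⊗ d₁ ⊖ (ι p₂ ⊖ ι o₂)

  module Line (a b : ℕ) (a²≡δb²+1 : a * a ≡ δ * (b * b) + 1) (θ : Zδ) (θ≡ℕ√ab : θ ≡ ℕ√ a b) where
    μ g W : Zδ
    μ = ℕ√ 0 b
    g = offset μ
    W = ιₙ a ⊗ ιₙ a

    1≤a : 1 ≤ a
    1≤a = x*x≡y+1⇒1≤x {a} a²≡δb²+1

    1+μ²≡W : 𝟙 ⊕ μ ⊗ μ ≡ W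
    1+μ²≡W = begin
      𝟙 ⊕ μ ⊗ μ                     ≡⟨ cong (𝟙 ⊕_) (ℕ√-⊗ 0 b 0 b) ⟩
      𝟙 ⊕ ℕ√ (δ * (b * b)) (b * 0)  ≡⟨ ℕ√-⊕ 1 0 (δ * (b * b)) (b * 0) ⟩
      ℕ√ (1 + δ * (b * b)) (b * 0)  ≡⟨ cong₂ ℕ√ (trans (+-comm 1 _) (sym a²≡δb²+1)) (*-zeroʳ b) ⟩
      ιₙ (a * a)                    ≡⟨ ιₙ-* a a ⟩
      W                             ∎
      where open ≡-Reasoning

    W≢𝟘 : W ≢ 𝟘
    W≢𝟘 W≡𝟘 = <⇒≢ (*-mono-≤ 1≤a 1≤a) (sym (ιₙ-injective {a * a} {0} (trans (ιₙ-* a a) W≡𝟘)))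

    μ≡√δ⊗b : μ ≡ √δ ⊗ ιₙ b
    μ≡√δ⊗b = sym (trans (ℕ√-⊗ 0 1 b 0) (cong₂ ℕ√ (*-zeroʳ δ) (+-identityʳ b)))

    θ²≡-1 : θ ⊗ θ ≡ ⊝ 𝟙 [mod ιₙ a ]
    θ²≡-1 = θ ⊕ θ , (begin
      θ ⊗ θ                 ≡⟨ solve 1 (λ t → t :* t := :- con (+ 1) :+ (t :* t :+ con (+ 1))) refl θ ⟩
      ⊝ 𝟙 ⊕ (θ ⊗ θ ⊕ 𝟙)     ≡⟨ cong (ι (- + 1) ⊕_) θ²+1≡a[θ+θ] ⟩
      ⊝ 𝟙 ⊕ ιₙ a ⊗ (θ ⊕ θ)  ∎)
      where
      open ≡-Reasoning
      θ²+1≡a[θ+θ] : θ ⊗ θ ⊕ 𝟙 ≡ ιₙ a ⊗ (θ ⊕ θ)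
      θ²+1≡a[θ+θ] = subst (λ t → t ⊗ t ⊕ 𝟙 ≡ ιₙ a ⊗ (t ⊕ t)) (sym θ≡ℕ√ab) (begin
        ℕ√ a b ⊗ ℕ√ a b ⊕ 𝟙                               ≡⟨ cong (_⊕ 𝟙) (ℕ√-⊗ a b a b) ⟩
        ℕ√ (a * a + δ * (b * b)) (a * b + b * a) ⊕ 𝟙      ≡⟨ ℕ√-⊕ _ _ 1 0 ⟩
        ℕ√ (a * a + δ * (b * b) + 1) (a * b + b * a + 0)  ≡⟨ cong₂ ℕ√ re-eq im-eq ⟩
        ℕ√ (a * (a + a)) (a * (b + b))                    ≡⟨ ιₙ-⊗-ℕ√ a (a + a) (b + b) ⟨
        ιₙ a ⊗ ℕ√ (a + a) (b + b)                         ≡⟨ cong (ιₙ a ⊗_) (ℕ√-⊕ a b a b) ⟨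
        ιₙ a ⊗ (ℕ√ a b ⊕ ℕ√ a b)                          ∎)
        where
        re-eq : a * a + δ * (b * b) + 1 ≡ a * (a + a)
        re-eq = trans (+-assoc (a * a) _ 1) (trans (cong (_+_ (a * a)) (sym a²≡δb²+1)) (sym (*-distribˡ-+ a a a)))
        im-eq : a * b + b * a + 0 ≡ a * (b + b)
        im-eq = trans (+-identityʳ _) (trans (cong (_+_ (a * b)) (*-comm b a)) (sym (*-distribˡ-+ a b b)))

    θ⁴≡1 : θ ^ 4 ≡ 𝟙 [mod ιₙ a ]
    θ⁴≡1 = subst₂ (λ x y → x ≡ y [mod ιₙ a ])
      (solve 1 (λ t → (t :* t) :* (t :* t) := t :* (t :* (t :* (t :* con (+ 1))))) refl θ)
      (solve 0 ((:- con (+ 1)) :* (:- con (+ 1)) := con (+ 1)) refl)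
      (≡-mod-⊗ {θ ⊗ θ} {⊝ 𝟙} {θ ⊗ θ} {⊝ 𝟙} {ιₙ a} θ²≡-1 θ²≡-1)

    θ^[4a]≡1 : θ ^ (a * 4) ≡ 𝟙 [mod W ]
    θ^[4a]≡1 = subst (λ x → x ≡ 𝟙 [mod W ]) (sym (^-* θ a 4)) (≡1-mod⇒^≡1-mod-square {θ ^ 4} a θ⁴≡1)

    θ^[1+4ak]≡θ : ∀ k → θ ^ (1 + k * (a * 4)) ≡ θ [mod W ]
    θ^[1+4ak]≡θ k = θ ⊗ r , (begin
      θ ⊗ θ ^ (k * (a * 4))  ≡⟨ cong (θ ⊗_) (^-* θ k (a * 4)) ⟩
      θ ⊗ (θ ^ (a * 4)) ^ k  ≡⟨ cong (θ ⊗_) θ^[4ak]≡1+Wr ⟩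
      θ ⊗ (𝟙 ⊕ W ⊗ r)        ≡⟨ solve 3 (λ t w r → t :* (con (+ 1) :+ w :* r) := t :+ w :* (t :* r)) refl θ W r ⟩
      θ ⊕ W ⊗ (θ ⊗ r)        ∎)
      where
      open ≡-Reasoning
      θ^[4ak]≡1 : (θ ^ (a * 4)) ^ k ≡ 𝟙 [mod W ]
      θ^[4ak]≡1 = ≡1-mod⇒^≡1-mod {θ ^ (a * 4)} {W} θ^[4a]≡1 k
      r : Zδ
      r = proj₁ θ^[4ak]≡1
      θ^[4ak]≡1+Wr : (θ ^ (a * 4)) ^ k ≡ 𝟙 ⊕ W ⊗ r
      θ^[4ak]≡1+Wr = proj₂ θ^[4ak]≡1

    module Circle (X Y : ℕ → ℕ) (X²≡δY²+1 : ∀ k → X k * X k ≡ δ * (Y k * Y k) + 1)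
                  (ℕ√XY≡θ^[1+4ak] : ∀ k → ℕ√ (X k) (Y k) ≡ θ ^ (1 + k * (a * 4))) where

      ν : ℕ → Zδ
      ν k = proj₁ (θ^[1+4ak]≡θ k)

      c e′ : ℕ → ℤ
      c k = + 1 +ℤ + a *ℤ re (ν k)
      e′ k = im (ν k)

      components : ∀ k → ℕ√ (X k) (Y k) ≡ (+ a +ℤ + (a * a) *ℤ re (ν k)) + (+ b +ℤ + (a * a) *ℤ im (ν k)) √
      components k = begin
        ℕ√ (X k) (Y k)                                                     ≡⟨ ℕ√XY≡θ^[1+4ak] k ⟩
        θ ^ (1 + k * (a * 4))                                              ≡⟨ proj₂ (θ^[1+4ak]≡θ k) ⟩
        θ ⊕ W ⊗ ν k                                                        ≡⟨ cong₂ (λ t w → t ⊕ w ⊗ ν k) (sym θ≡ℕ√ab) (ιₙ-* a a) ⟨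
        ℕ√ a b ⊕ ιₙ (a * a) ⊗ ν k                                          ≡⟨ cong (ℕ√ a b ⊕_) (ι-⊗-componentwise (+ (a * a)) (ν k)) ⟩
        (+ a +ℤ + (a * a) *ℤ re (ν k)) + (+ b +ℤ + (a * a) *ℤ im (ν k)) √  ∎
        where open ≡-Reasoning

      ιX≡a⊗c : ∀ k → ιₙ (X k) ≡ ιₙ a ⊗ ι (c k)
      ιX≡a⊗c k = trans (cong ι X≡ac) (ι-⊗ (+ a) (c k))
        where
        a+a²r≡a[1+ar] : ∀ a r → a +ℤ (a *ℤ a) *ℤ r ≡ a *ℤ (+ 1 +ℤ a *ℤ r)
        a+a²r≡a[1+ar] = ℤ-Solver.solve-∀
        X≡ac : + X k ≡ + a *ℤ c k
        X≡ac = trans (cong re (components k)) (trans (cong (λ z → + a +ℤ z *ℤ re (ν k)) (ℤ.pos-* a a)) (a+a²r≡a[1+ar] (+ a) (re (ν k))))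

      ιY≡b+We′ : ∀ k → ιₙ (Y k) ≡ ιₙ b ⊕ W ⊗ ι (e′ k)
      ιY≡b+We′ k = begin
        ι (+ Y k)                     ≡⟨ cong (ι ∘ im) (components k) ⟩
        ι (+ b +ℤ + (a * a) *ℤ e′ k)  ≡⟨ ι-⊕ (+ b) (+ (a * a) *ℤ e′ k) ⟩
        ιₙ b ⊕ ι (+ (a * a) *ℤ e′ k)  ≡⟨ cong (ιₙ b ⊕_) (ι-⊗ (+ (a * a)) (e′ k)) ⟩
        ιₙ b ⊕ ιₙ (a * a) ⊗ ι (e′ k)  ≡⟨ cong (λ w → ιₙ b ⊕ w ⊗ ι (e′ k)) (ιₙ-* a a) ⟩
        ιₙ b ⊕ W ⊗ ι (e′ k)           ∎
        where open ≡-Reasoning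

      -- τ = g√δ(Y − b)/a² and radius = gX/a, see components.
      τ radius : ℕ → Zδ
      τ k = g ⊗ (√δ ⊗ ι (e′ k))
      radius k = g ⊗ ι (c k)

      on-circle : ∀ k → radius k ⊗ radius k ≡ τ k ⊗ τ k ⊕ (μ ⊗ τ k ⊕ g) ⊗ (μ ⊗ τ k ⊕ g)
      on-circle k = sym (⊗-cancelˡ {W} W≢𝟘 (begin
        W ⊗ (τ k ⊗ τ k ⊕ (μ ⊗ τ k ⊕ g) ⊗ (μ ⊗ τ k ⊕ g))        ≡⟨ completing-the-square μ W (τ k) g 1+μ²≡W ⟩
        (W ⊗ τ k ⊕ μ ⊗ g) ⊗ (W ⊗ τ k ⊕ μ ⊗ g) ⊕ g ⊗ g          ≡⟨ cong (λ z → z ⊗ z ⊕ g ⊗ g) Wτ+μg≡g√δY ⟩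
        (g ⊗ (√δ ⊗ ιₙ (Y k))) ⊗ (g ⊗ (√δ ⊗ ιₙ (Y k))) ⊕ g ⊗ g  ≡⟨ [g[sy]]²+g²≡g²[s²y²+1] g √δ (ιₙ (Y k)) ⟩
        (g ⊗ g) ⊗ ((√δ ⊗ √δ) ⊗ (ιₙ (Y k) ⊗ ιₙ (Y k)) ⊕ 𝟙)      ≡⟨ cong (λ d → (g ⊗ g) ⊗ (d ⊗ (ιₙ (Y k) ⊗ ιₙ (Y k)) ⊕ 𝟙)) √δ⊗√δ ⟩
        (g ⊗ g) ⊗ (ιₙ δ ⊗ (ιₙ (Y k) ⊗ ιₙ (Y k)) ⊕ 𝟙)           ≡⟨ cong ((g ⊗ g) ⊗_) (pell⇒ιₙ {X k} {Y k} (X²≡δY²+1 k)) ⟨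
        (g ⊗ g) ⊗ (ιₙ (X k) ⊗ ιₙ (X k))                        ≡⟨ cong (λ x → (g ⊗ g) ⊗ (x ⊗ x)) (ιX≡a⊗c k) ⟩
        (g ⊗ g) ⊗ ((ιₙ a ⊗ ι (c k)) ⊗ (ιₙ a ⊗ ι (c k)))        ≡⟨ g²[ac]²≡a²[gc]² g (ιₙ a) (ι (c k)) ⟩
        W ⊗ (radius k ⊗ radius k)                              ∎))
        where
        open ≡-Reasoning
        Wτ+μg≡g√δY : W ⊗ τ k ⊕ μ ⊗ g ≡ g ⊗ (√δ ⊗ ιₙ (Y k))
        Wτ+μg≡g√δY = begin
          W ⊗ τ k ⊕ μ ⊗ g                   ≡⟨ cong (λ m → W ⊗ τ k ⊕ m ⊗ g) μ≡√δ⊗b ⟩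
          W ⊗ τ k ⊕ (√δ ⊗ ιₙ b) ⊗ g         ≡⟨ W[g[se]]+[sb]g≡g[s[b+We]] W g √δ (ι (e′ k)) (ιₙ b) ⟩
          g ⊗ (√δ ⊗ (ιₙ b ⊕ W ⊗ ι (e′ k)))  ≡⟨ cong (λ y → g ⊗ (√δ ⊗ y)) (ιY≡b+We′ k) ⟨
          g ⊗ (√δ ⊗ ιₙ (Y k))               ∎

      τ-injective : (∀ {k l} → Y k ≡ Y l → k ≡ l) → g ≢ 𝟘 → ∀ {k l} → τ k ≡ τ l → k ≡ l
      τ-injective Y-injective g≢𝟘 {k} {l} τk≡τl = Y-injective (ℤ.+-injective (begin
        + Y k                     ≡⟨ cong re (ιY≡b+We′ k) ⟩
        re (ιₙ b ⊕ W ⊗ ι (e′ k))  ≡⟨ cong (λ e → re (ιₙ b ⊕ W ⊗ ι e)) e′k≡e′l ⟩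
        re (ιₙ b ⊕ W ⊗ ι (e′ l))  ≡⟨ cong re (ιY≡b+We′ l) ⟨
        + Y l                     ∎))
        where
        open ≡-Reasoning
        e′k≡e′l : e′ k ≡ e′ l
        e′k≡e′l = cong re (⊗-cancelˡ {√δ} {ι (e′ k)} {ι (e′ l)} (λ ())
                             (⊗-cancelˡ {g} {√δ ⊗ ι (e′ k)} {√δ ⊗ ι (e′ l)} g≢𝟘 τk≡τl))

  record LinePoints (μ : Zδ) : Set where
    field
      τ : ℕ → Zδ
      τ-injective : ∀ {k l} → τ k ≡ τ l → k ≡ l
      distance-to-P : ∀ k → ∃[ r ] r ⊗ r ≡ τ k ⊗ τ k ⊕ (μ ⊗ τ k ⊕ offset μ) ⊗ (μ ⊗ τ k ⊕ offset μ)

  slope : ℕ → Zδ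
  slope j = ℕ√ 0 (B (suc j))

  slope-injective : ∀ {i j} → slope i ≡ slope j → i ≡ j
  slope-injective = suc-injective ∘ B-injective ∘ proj₂ ∘ ℕ√-injective

  module LineOfSlope (j : ℕ) where
    a : ℕ
    a = A (suc j)

    open Line a (B (suc j)) (A²≡δB²+1 (suc j)) (ε ^ suc j) (ε^n≡ℕ√[An,Bn] (suc j)) public

    exponent : ℕ → ℕ
    exponent k = (1 + k * (a * 4)) * suc j

    exponent-injective : ∀ {k l} → exponent k ≡ exponent l → k ≡ l
    exponent-injective {k} {l} eq =
      *-cancelʳ-≡ k l (a * 4) {{>-nonZero (*-mono-≤ 1≤a (s≤s z≤n))}} (suc-injective (*-cancelʳ-≡ _ _ (suc j) eq))

    open Circle (A ∘ exponent) (B ∘ exponent) (A²≡δB²+1 ∘ exponent)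
                (λ k → trans (sym (ε^n≡ℕ√[An,Bn] (exponent k))) (^-* ε (1 + k * (a * 4)) (suc j))) public

    -- If g ≡ 𝟘 then P lies on the line, and every point of it is at distance a·τ from P.
    line-points : Dec (g ≡ 𝟘) → LinePoints (slope j)
    line-points (yes g≡𝟘) = record
      { τ = ιₙ
      ; τ-injective = ιₙ-injective
      ; distance-to-P = λ k → ιₙ a ⊗ ιₙ k , (begin
          (ιₙ a ⊗ ιₙ k) ⊗ (ιₙ a ⊗ ιₙ k)                  ≡⟨ [wt]²≡t²w² (ιₙ a) (ιₙ k) ⟩
          (ιₙ k ⊗ ιₙ k) ⊗ W                              ≡⟨ cong ((ιₙ k ⊗ ιₙ k) ⊗_) 1+μ²≡W ⟨
          (ιₙ k ⊗ ιₙ k) ⊗ (𝟙 ⊕ μ ⊗ μ)                    ≡⟨ through-point μ (ιₙ k) ⟩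
          ιₙ k ⊗ ιₙ k ⊕ (μ ⊗ ιₙ k ⊕ 𝟘) ⊗ (μ ⊗ ιₙ k ⊕ 𝟘)  ≡⟨ cong (λ z → ιₙ k ⊗ ιₙ k ⊕ (μ ⊗ ιₙ k ⊕ z) ⊗ (μ ⊗ ιₙ k ⊕ z)) g≡𝟘 ⟨
          ιₙ k ⊗ ιₙ k ⊕ (μ ⊗ ιₙ k ⊕ g) ⊗ (μ ⊗ ιₙ k ⊕ g)  ∎)
      }
      where open ≡-Reasoning
    line-points (no g≢𝟘) = record
      { τ = τ
      ; τ-injective = τ-injective (exponent-injective ∘ B-injective) g≢𝟘
      ; distance-to-P = λ k → radius k , on-circle k
      }

  points : ∀ j → LinePoints (slope j)
  points j = LineOfSlope.line-points j (offset (slope j) ≟ 𝟘)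

  T : ℕ → ℕ → Zδ
  T j k = d₁ ⊕ LinePoints.τ (points j) k

  T-injective : ∀ j {k l} → T j k ≡ T j l → k ≡ l
  T-injective j = LinePoints.τ-injective (points j) ∘ ⊕-cancelˡ d₁

  on-both-circles : ∀ j k → let Q = (ι o₁ ⊕ T j k , ι o₂ ⊕ slope j ⊗ T j k) in
                    Ring.DistIn δ (o₁ , o₂) Q × Ring.DistIn δ (p₁ , p₂) Q
  on-both-circles j k = (ιₙ (LineOfSlope.a j) ⊗ T j k , (begin
      (ιₙ (LineOfSlope.a j) ⊗ T j k) ⊗ (ιₙ (LineOfSlope.a j) ⊗ T j k)  ≡⟨ [wt]²≡t²w² (ιₙ (LineOfSlope.a j)) (T j k) ⟩
      (T j k ⊗ T j k) ⊗ LineOfSlope.W j                                ≡⟨ cong ((T j k ⊗ T j k) ⊗_) (LineOfSlope.1+μ²≡W j) ⟨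
      (T j k ⊗ T j k) ⊗ (𝟙 ⊕ slope j ⊗ slope j)                        ≡⟨ sqDist-on-line o₁ o₂ (T j k) (slope j) ⟨
      sqDist (o₁ , o₂) (ι o₁ ⊕ T j k , ι o₂ ⊕ slope j ⊗ T j k)         ∎))
    , (proj₁ (LinePoints.distance-to-P (points j) k) ,
       trans (proj₂ (LinePoints.distance-to-P (points j) k)) (sym (sqDist-from-line o₁ o₂ p₁ p₂ (LinePoints.τ (points j) k) (slope j))))
    where open ≡-Reasoning

  dense : Ring.ZariskiDense δ (λ Q → Ring.DistIn δ (o₁ , o₂) Q × Ring.DistIn δ (p₁ , p₂) Q)
  dense = Polynomials.Pencil.dense δ-nonsquare (ε ^_) (conj ∘ (ε ^_)) conj-ε^⊗ε^≡𝟙 ε^-injective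
                                   (ι o₁) (ι o₂) slope slope-injective T T-injective on-both-circles

theorem8p1 : (δ : ℕ) → 1 ≤ δ → ¬ IsSquare δ → (O P : ℤ × ℤ) →
    Ring.ZariskiDense δ (λ Q → Ring.DistIn δ O Q × Ring.DistIn δ P Q)
theorem8p1 δ _ δ-nonsquare (o₁ , o₂) (p₁ , p₂) = Construction.dense δ-nonsquare o₁ o₂ p₁ p₂
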